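{- For an irreducible fraction $\frac{r}{s}>1$, the polynomial $\mathcal{R}_{\frac{r}{s}}(q)$ is palindromic if and only if $s^2\equiv 1\pmod r$.
   Context: For an integer $c$, $[c]_q=\frac{1-q^c}{1-q}$. Every rational $\alpha>1$ has a unique negative continued fraction expansion $\alpha=c_1-\cfrac{1}{c_2-\cfrac{1}{\ddots-\cfrac{1}{c_l}}}$ with integers $c_j\ge 2$. Put $M^-_q(c)=\begin{pmatrix}[c]_q & -q^{c-1}\\ 1 & 0\end{pmatrix}$ and define $\mathcal{R}_\alpha(q),\mathcal{S}_\alpha(q)\in\mathbb Z[q]$ by $\begin{pmatrix}\mathcal{R}_\alpha(q)\\ \mathcal{S}_\alpha(q)\end{pmatrix}=M^-_q(c_1)\cdots M^-_q(c_l)\begin{pmatrix}1\\0\end{pmatrix}$. A polynomial $f$ is palindromic if $q^{\deg f}f(q^{ -1})=f(q)$. An irreducible fraction $\frac{r}{s}$ means $\gcd(r,s)=1$, $s>0$. -}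

module Defs where

open import Data.Nat using (ℕ; zero; suc)
open import Data.Integer as ℤ using (ℤ; +_; 0ℤ; 1ℤ)
open import Data.Rational as ℚ using (ℚ)
open import Data.List using (List; []; _∷_; reverse)
open import Data.List.NonEmpty using (List⁺; _∷_)
open import Relation.Nullary using (yes; no)
open import Relation.Binary.PropositionalEquality using (_≡_)

-- total reciprocal (1/0 := 0); only used on values > 1
inv : ℚ → ℚ
inv p with p ℚ.≟ ℚ.0ℚ
... | yes _ = ℚ.0ℚ
... | no p≢0 = ℚ.1/_ p {{ℚ.≢-nonZero p≢0}}

ncfList : ℕ → List ℕ → ℚ
ncfList c []       = ℚ._/_ (+ c) 1
ncfList c (d ∷ ds) = ℚ._/_ (+ c) 1 ℚ.- inv (ncfList d ds)

ncf : List⁺ ℕ → ℚ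
ncf (c ∷ cs) = ncfList c cs

-- Polynomials in ℤ[q] as coefficient lists, constant term first

Poly : Set
Poly = List ℤ

_⊕_ : Poly → Poly → Poly
[]       ⊕ g        = g
(a ∷ f)  ⊕ []       = a ∷ f
(a ∷ f)  ⊕ (b ∷ g)  = (a ℤ.+ b) ∷ (f ⊕ g)

scale : ℤ → Poly → Poly
scale a []      = []
scale a (b ∷ f) = (a ℤ.* b) ∷ scale a f

_⊗_ : Poly → Poly → Poly
[]      ⊗ g = []
(a ∷ f) ⊗ g = scale a g ⊕ (0ℤ ∷ (f ⊗ g))

neg : Poly → Poly
neg = scale (ℤ.- 1ℤ)

qpow : ℕ → Poly
qpow zero    = 1ℤ ∷ []
qpow (suc n) = 0ℤ ∷ qpow n

qint : ℕ → Poly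
qint zero    = []
qint (suc c) = 1ℤ ∷ qint c

-- q^{c-1}, for c ≥ 1 (the only case used, since all c_j ≥ 2)
qpowPred : ℕ → Poly
qpowPred zero    = []
qpowPred (suc c) = qpow c

-- M⁻_q(c) · (x , y) = ([c]_q x - q^{c-1} y , x)
record PolyPair : Set where
  constructor ⟨_,_⟩
  field
    fst snd : Poly

Mstep : ℕ → PolyPair → PolyPair
Mstep c ⟨ x , y ⟩ = ⟨ (qint c ⊗ x) ⊕ neg (qpowPred c ⊗ y) , x ⟩

-- M⁻_q(c₁) ⋯ M⁻_q(c_l) (1 , 0)ᵀ
MprodList : List ℕ → PolyPair
MprodList []       = ⟨ 1ℤ ∷ [] , [] ⟩
MprodList (c ∷ cs) = Mstep c (MprodList cs)

Rpoly : List⁺ ℕ → Poly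
Rpoly (c ∷ cs) = PolyPair.fst (MprodList (c ∷ cs))

trim : Poly → Poly
trim []      = []
trim (a ∷ f) with trim f
... | g ∷ gs = a ∷ g ∷ gs
... | [] with a ℤ.≟ 0ℤ
...   | yes _ = []
...   | no _  = a ∷ []

-- q^{deg f} f(q⁻¹) = f(q): the coefficient sequence read backwards
-- (from the leading coefficient) equals the sequence itself
Palindromic : Poly → Set
Palindromic f = reverse (trim f) ≡ trim f

-- Write M⁻(c₁)⋯M⁻(cₗ) = (R U ; S V) over ℤ[q] and N = Σ (cᵢ − 1). Entrywise, q^(c−1) M⁻(c)(q⁻¹) is
-- D M⁻(c)ᵀ D with D = diag(1, −1), so qᴺ R(q⁻¹) is the R-polynomial of the reversed expansion [cₗ, …, c₁].
-- At q = 1 the product is (r u ; s v) with rv − us = 1, and differentiating gives 2R′(1) = N r + s + u.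
-- A palindrome of degree d has 2R′(1) = d R(1), so a palindromic R forces r ∣ s + u; since all cᵢ ≥ 2 give
-- −r < s + u < r, this means s + u = 0. Conversely, if s + u = 0 the reversed expansion has value r/(−u) = r/s,
-- so by uniqueness it is the same word and R equals its own reflection. Finally, by the determinant,
-- s + u = 0 iff r ∣ s² − 1.

module Submission where

open import Defs renaming (_⊕_ to infixl 6 _⊕_; _⊗_ to infixl 7 _⊗_)
open import Level using (0ℓ)
open import Algebra.Bundles using (CommutativeRing; CommutativeSemigroup)
open import Algebra.Structures using (IsCommutativeRing)
import Algebra.Properties.CommutativeSemigroup as CommSemigroupProperties
open import Data.Nat as ℕ using (ℕ; zero; suc; _≤_; _<_; z≤n; s≤s; NonZero)
import Data.Nat.Properties as ℕP
import Data.Nat.Divisibility as ℕD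
open import Data.Nat.Coprimality as Coprimality using (Coprime; coprime-divisor; 1-coprimeTo)
open import Data.Integer as ℤ using (ℤ; +_; -[1+_]; +≤+; 0ℤ; 1ℤ; _+_; _*_; -_; _-_) renaming (_≤_ to _≤ℤ_)
import Data.Integer.Properties as ℤP
open import Data.Integer.Divisibility using (_∣_)
import Data.Integer.Divisibility.Signed as ℤD
open import Data.Integer.Tactic.RingSolver using (solve-∀)
open import Data.Rational as ℚ using (mkℚ; toℚᵘ)
import Data.Rational.Properties as ℚP
open import Data.Rational.Unnormalised as ℚᵘ using (ℚᵘ; mkℚᵘ; ↥_; ↧_; _≃_; *≡*)
import Data.Rational.Unnormalised.Properties as ℚᵘP
open import Data.List using (List; []; _∷_; _++_; length; reverse)
import Data.List.Properties as LP
open import Data.List.NonEmpty using (List⁺; _∷_; toList)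
open import Data.List.Relation.Unary.All as All using (All; []; _∷_)
import Data.List.Relation.Unary.All.Properties as AllP
open import Data.Maybe using (nothing)
open import Data.Product using (Σ; _×_; _,_; proj₁; proj₂)
open import Data.Empty using (⊥-elim)
open import Function using (_$_; _∘_)
open import Function.Bundles using (_⇔_; mk⇔)
import Function.Properties.Equivalence as ⇔
open import Relation.Nullary using (yes; no)
open import Relation.Binary.Bundles using (Setoid)
open import Relation.Binary.Structures using (IsEquivalence)
open import Relation.Binary.PropositionalEquality
import Relation.Binary.Reasoning.Setoid as SetoidReasoning
import Tactic.RingSolver.Core.AlmostCommutativeRing as ACR
open import Tactic.RingSolver using () renaming (solve-∀ to ring-solve)

-- Polynomials up to trailing zeros

coeff : Poly → ℕ → ℤ
coeff []      i       = 0ℤ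
coeff (a ∷ f) zero    = a
coeff (a ∷ f) (suc i) = coeff f i

infix 4 _≈_
record _≈_ (f g : Poly) : Set where
  constructor mk≈
  field coeff-≡ : ∀ i → coeff f i ≡ coeff g i
open _≈_ public

≈-refl : ∀ {f} → f ≈ f
≈-refl = mk≈ λ _ → refl

≈-sym : ∀ {f g} → f ≈ g → g ≈ f
≈-sym p = mk≈ λ i → sym (coeff-≡ p i)

≈-trans : ∀ {f g h} → f ≈ g → g ≈ h → f ≈ h
≈-trans p q = mk≈ λ i → trans (coeff-≡ p i) (coeff-≡ q i)

≈-reflexive : ∀ {f g} → f ≡ g → f ≈ g
≈-reflexive refl = ≈-refl

≈-isEquivalence : IsEquivalence _≈_
≈-isEquivalence = record { refl = ≈-refl ; sym = ≈-sym ; trans = ≈-trans }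

≈-setoid : Setoid 0ℓ 0ℓ
≈-setoid = record { isEquivalence = ≈-isEquivalence }

module ≈-Reasoning = SetoidReasoning ≈-setoid

∷-cong : ∀ {a b f g} → a ≡ b → f ≈ g → a ∷ f ≈ b ∷ g
∷-cong a≡b f≈g = mk≈ λ { zero → a≡b ; (suc i) → coeff-≡ f≈g i }

∷-injective : ∀ {a b f g} → a ∷ f ≈ b ∷ g → f ≈ g
∷-injective p = mk≈ λ i → coeff-≡ p (suc i)

∷-[] : ∀ {a f} → a ∷ f ≈ [] → f ≈ []
∷-[] p = mk≈ λ i → coeff-≡ p (suc i)

[0]≈[] : 0ℤ ∷ [] ≈ []
[0]≈[] = mk≈ λ { zero → refl ; (suc i) → refl }

coeff-⊕ : ∀ f g i → coeff (f ⊕ g) i ≡ coeff f i + coeff g i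
coeff-⊕ []      g       i       = sym (ℤP.+-identityˡ (coeff g i))
coeff-⊕ (a ∷ f) []      i       = sym (ℤP.+-identityʳ (coeff (a ∷ f) i))
coeff-⊕ (a ∷ f) (b ∷ g) zero    = refl
coeff-⊕ (a ∷ f) (b ∷ g) (suc i) = coeff-⊕ f g i

coeff-scale : ∀ a f i → coeff (scale a f) i ≡ a * coeff f i
coeff-scale a []      i       = sym (ℤP.*-zeroʳ a)
coeff-scale a (b ∷ f) zero    = refl
coeff-scale a (b ∷ f) (suc i) = coeff-scale a f i

coeff-neg : ∀ f i → coeff (neg f) i ≡ - coeff f i
coeff-neg f i = trans (coeff-scale (- 1ℤ) f i) (ℤP.-1*i≡-i (coeff f i))

⊕-cong : ∀ {f f′ g g′} → f ≈ f′ → g ≈ g′ → f ⊕ g ≈ f′ ⊕ g′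
⊕-cong {f} {f′} {g} {g′} p q = mk≈ λ i → begin
  coeff (f ⊕ g) i              ≡⟨ coeff-⊕ f g i ⟩
  coeff f i + coeff g i        ≡⟨ cong₂ _+_ (coeff-≡ p i) (coeff-≡ q i) ⟩
  coeff f′ i + coeff g′ i      ≡⟨ coeff-⊕ f′ g′ i ⟨
  coeff (f′ ⊕ g′) i            ∎
  where open ≡-Reasoning

⊕-assoc : ∀ f g h → (f ⊕ g) ⊕ h ≈ f ⊕ (g ⊕ h)
⊕-assoc f g h = mk≈ λ i → begin
  coeff ((f ⊕ g) ⊕ h) i                ≡⟨ coeff-⊕ (f ⊕ g) h i ⟩
  coeff (f ⊕ g) i + coeff h i          ≡⟨ cong (_+ coeff h i) (coeff-⊕ f g i) ⟩
  coeff f i + coeff g i + coeff h i    ≡⟨ ℤP.+-assoc (coeff f i) (coeff g i) (coeff h i) ⟩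
  coeff f i + (coeff g i + coeff h i)  ≡⟨ cong (λ z → coeff f i + z) (coeff-⊕ g h i) ⟨
  coeff f i + coeff (g ⊕ h) i          ≡⟨ coeff-⊕ f (g ⊕ h) i ⟨
  coeff (f ⊕ (g ⊕ h)) i                ∎
  where open ≡-Reasoning

⊕-comm : ∀ f g → f ⊕ g ≈ g ⊕ f
⊕-comm f g = mk≈ λ i → begin
  coeff (f ⊕ g) i        ≡⟨ coeff-⊕ f g i ⟩
  coeff f i + coeff g i  ≡⟨ ℤP.+-comm (coeff f i) (coeff g i) ⟩
  coeff g i + coeff f i  ≡⟨ coeff-⊕ g f i ⟨
  coeff (g ⊕ f) i        ∎
  where open ≡-Reasoning

⊕-identityʳ : ∀ f → f ⊕ [] ≈ f
⊕-identityʳ f = mk≈ λ i → trans (coeff-⊕ f [] i) (ℤP.+-identityʳ (coeff f i))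

neg-cong : ∀ {f g} → f ≈ g → neg f ≈ neg g
neg-cong {f} {g} p = mk≈ λ i →
  trans (coeff-neg f i) (trans (cong -_ (coeff-≡ p i)) (sym (coeff-neg g i)))

neg-inverseʳ : ∀ f → f ⊕ neg f ≈ []
neg-inverseʳ f = mk≈ λ i → begin
  coeff (f ⊕ neg f) i            ≡⟨ coeff-⊕ f (neg f) i ⟩
  coeff f i + coeff (neg f) i    ≡⟨ cong (λ z → coeff f i + z) (coeff-neg f i) ⟩
  coeff f i + - coeff f i        ≡⟨ ℤP.+-inverseʳ (coeff f i) ⟩
  0ℤ                             ∎
  where open ≡-Reasoning

scale-cong : ∀ a {f g} → f ≈ g → scale a f ≈ scale a g
scale-cong a {f} {g} p = mk≈ λ i →
  trans (coeff-scale a f i) (trans (cong (a *_) (coeff-≡ p i)) (sym (coeff-scale a g i)))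

scale-zero : ∀ f → scale 0ℤ f ≈ []
scale-zero f = mk≈ λ i → coeff-scale 0ℤ f i

scale-one : ∀ f → scale 1ℤ f ≈ f
scale-one f = mk≈ λ i → trans (coeff-scale 1ℤ f i) (ℤP.*-identityˡ (coeff f i))

scale-distrib-⊕ : ∀ a f g → scale a (f ⊕ g) ≈ scale a f ⊕ scale a g
scale-distrib-⊕ a f g = mk≈ λ i → begin
  coeff (scale a (f ⊕ g)) i                  ≡⟨ coeff-scale a (f ⊕ g) i ⟩
  a * coeff (f ⊕ g) i                        ≡⟨ cong (a *_) (coeff-⊕ f g i) ⟩
  a * (coeff f i + coeff g i)                ≡⟨ ℤP.*-distribˡ-+ a (coeff f i) (coeff g i) ⟩
  a * coeff f i + a * coeff g i              ≡⟨ cong₂ _+_ (coeff-scale a f i) (coeff-scale a g i) ⟨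
  coeff (scale a f) i + coeff (scale a g) i  ≡⟨ coeff-⊕ (scale a f) (scale a g) i ⟨
  coeff (scale a f ⊕ scale a g) i            ∎
  where open ≡-Reasoning

scale-distrib-+ : ∀ a b f → scale (a + b) f ≈ scale a f ⊕ scale b f
scale-distrib-+ a b f = mk≈ λ i → begin
  coeff (scale (a + b) f) i                  ≡⟨ coeff-scale (a + b) f i ⟩
  (a + b) * coeff f i                        ≡⟨ ℤP.*-distribʳ-+ (coeff f i) a b ⟩
  a * coeff f i + b * coeff f i              ≡⟨ cong₂ _+_ (coeff-scale a f i) (coeff-scale b f i) ⟨
  coeff (scale a f) i + coeff (scale b f) i  ≡⟨ coeff-⊕ (scale a f) (scale b f) i ⟨
  coeff (scale a f ⊕ scale b f) i            ∎
  where open ≡-Reasoning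

scale-assoc : ∀ a b f → scale (a * b) f ≈ scale a (scale b f)
scale-assoc a b f = mk≈ λ i → begin
  coeff (scale (a * b) f) i    ≡⟨ coeff-scale (a * b) f i ⟩
  a * b * coeff f i            ≡⟨ ℤP.*-assoc a b (coeff f i) ⟩
  a * (b * coeff f i)          ≡⟨ cong (a *_) (coeff-scale b f i) ⟨
  a * coeff (scale b f) i      ≡⟨ coeff-scale a (scale b f) i ⟨
  coeff (scale a (scale b f)) i ∎
  where open ≡-Reasoning

⊕-commutativeSemigroup : CommutativeSemigroup 0ℓ 0ℓ
⊕-commutativeSemigroup = record
  { _≈_ = _≈_ ; _∙_ = _⊕_
  ; isCommutativeSemigroup = record
    { isSemigroup = record
      { isMagma = record { isEquivalence = ≈-isEquivalence ; ∙-cong = ⊕-cong }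
      ; assoc = ⊕-assoc }
    ; comm = ⊕-comm } }

open CommSemigroupProperties ⊕-commutativeSemigroup public
  using () renaming (interchange to ⊕-interchange; x∙yz≈y∙xz to ⊕-left-comm)

one : Poly
one = 1ℤ ∷ []

scale-≡ : ∀ {a b} f → a ≡ b → scale a f ≈ scale b f
scale-≡ f refl = ≈-refl

⊗-zeroˡ : ∀ f g → f ≈ [] → f ⊗ g ≈ []
⊗-zeroˡ []      g p = ≈-refl
⊗-zeroˡ (a ∷ f) g p = begin
  scale a g ⊕ (0ℤ ∷ f ⊗ g)  ≈⟨ ⊕-cong (scale-≡ g (coeff-≡ p 0)) (∷-cong refl (⊗-zeroˡ f g (∷-[] p))) ⟩
  scale 0ℤ g ⊕ (0ℤ ∷ [])    ≈⟨ ⊕-cong (scale-zero g) [0]≈[] ⟩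
  []                        ∎
  where open ≈-Reasoning

⊗-zeroʳ : ∀ f → f ⊗ [] ≈ []
⊗-zeroʳ []      = ≈-refl
⊗-zeroʳ (a ∷ f) = ≈-trans (∷-cong refl (⊗-zeroʳ f)) [0]≈[]

⊗-congˡ : ∀ {f f′} g → f ≈ f′ → f ⊗ g ≈ f′ ⊗ g
⊗-congˡ {[]}    {f′}     g p = ≈-sym (⊗-zeroˡ f′ g (≈-sym p))
⊗-congˡ {a ∷ f} {[]}     g p = ⊗-zeroˡ (a ∷ f) g p
⊗-congˡ {a ∷ f} {b ∷ f′} g p =
  ⊕-cong (scale-≡ g (coeff-≡ p 0)) (∷-cong refl (⊗-congˡ g (∷-injective p)))

⊗-congʳ : ∀ f {g g′} → g ≈ g′ → f ⊗ g ≈ f ⊗ g′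
⊗-congʳ []      p = ≈-refl
⊗-congʳ (a ∷ f) p = ⊕-cong (scale-cong a p) (∷-cong refl (⊗-congʳ f p))

⊗-cong : ∀ {f f′ g g′} → f ≈ f′ → g ≈ g′ → f ⊗ g ≈ f′ ⊗ g′
⊗-cong {f′ = f′} {g} p q = ≈-trans (⊗-congˡ g p) (⊗-congʳ f′ q)

⊗-shiftˡ : ∀ f g → (0ℤ ∷ f) ⊗ g ≈ 0ℤ ∷ f ⊗ g
⊗-shiftˡ f g = ⊕-cong (scale-zero g) ≈-refl

⊗-identityˡ : ∀ f → one ⊗ f ≈ f
⊗-identityˡ f = ≈-trans (⊕-cong (scale-one f) [0]≈[]) (⊕-identityʳ f)

scale-⊗ˡ : ∀ a f g → scale a f ⊗ g ≈ scale a (f ⊗ g)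
scale-⊗ˡ a []      g = ≈-refl
scale-⊗ˡ a (b ∷ f) g = begin
  scale (a * b) g ⊕ (0ℤ ∷ scale a f ⊗ g)       ≈⟨ ⊕-cong (scale-assoc a b g) (∷-cong (sym (ℤP.*-zeroʳ a)) (scale-⊗ˡ a f g)) ⟩
  scale a (scale b g) ⊕ scale a (0ℤ ∷ f ⊗ g)   ≈⟨ scale-distrib-⊕ a (scale b g) (0ℤ ∷ f ⊗ g) ⟨
  scale a (scale b g ⊕ (0ℤ ∷ f ⊗ g))           ∎
  where open ≈-Reasoning

⊗-distribʳ : ∀ h f g → (f ⊕ g) ⊗ h ≈ (f ⊗ h) ⊕ (g ⊗ h)
⊗-distribʳ h []      g       = ≈-refl
⊗-distribʳ h (a ∷ f) []      = ≈-sym (⊕-identityʳ ((a ∷ f) ⊗ h))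
⊗-distribʳ h (a ∷ f) (b ∷ g) = begin
  scale (a + b) h ⊕ (0ℤ ∷ (f ⊕ g) ⊗ h)
    ≈⟨ ⊕-cong (scale-distrib-+ a b h) (∷-cong refl (⊗-distribʳ h f g)) ⟩
  (scale a h ⊕ scale b h) ⊕ ((0ℤ ∷ f ⊗ h) ⊕ (0ℤ ∷ g ⊗ h))
    ≈⟨ ⊕-interchange (scale a h) (scale b h) (0ℤ ∷ f ⊗ h) (0ℤ ∷ g ⊗ h) ⟩
  (scale a h ⊕ (0ℤ ∷ f ⊗ h)) ⊕ (scale b h ⊕ (0ℤ ∷ g ⊗ h))
    ∎
  where open ≈-Reasoning

⊗-distribˡ : ∀ f g h → f ⊗ (g ⊕ h) ≈ (f ⊗ g) ⊕ (f ⊗ h)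
⊗-distribˡ []      g h = ≈-refl
⊗-distribˡ (a ∷ f) g h = begin
  scale a (g ⊕ h) ⊕ (0ℤ ∷ f ⊗ (g ⊕ h))
    ≈⟨ ⊕-cong (scale-distrib-⊕ a g h) (∷-cong refl (⊗-distribˡ f g h)) ⟩
  (scale a g ⊕ scale a h) ⊕ ((0ℤ ∷ f ⊗ g) ⊕ (0ℤ ∷ f ⊗ h))
    ≈⟨ ⊕-interchange (scale a g) (scale a h) (0ℤ ∷ f ⊗ g) (0ℤ ∷ f ⊗ h) ⟩
  (scale a g ⊕ (0ℤ ∷ f ⊗ g)) ⊕ (scale a h ⊕ (0ℤ ∷ f ⊗ h))
    ∎
  where open ≈-Reasoning

⊗-consʳ : ∀ f b g → f ⊗ (b ∷ g) ≈ scale b f ⊕ (0ℤ ∷ f ⊗ g)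
⊗-consʳ []      b g = ≈-sym [0]≈[]
⊗-consʳ (a ∷ f) b g = ∷-cong (cong (_+ 0ℤ) (ℤP.*-comm a b)) (begin
  scale a g ⊕ (f ⊗ (b ∷ g))                 ≈⟨ ⊕-cong ≈-refl (⊗-consʳ f b g) ⟩
  scale a g ⊕ (scale b f ⊕ (0ℤ ∷ f ⊗ g))    ≈⟨ ⊕-left-comm (scale a g) (scale b f) (0ℤ ∷ f ⊗ g) ⟩
  scale b f ⊕ (scale a g ⊕ (0ℤ ∷ f ⊗ g))    ∎)
  where open ≈-Reasoning

⊗-comm : ∀ f g → f ⊗ g ≈ g ⊗ f
⊗-comm []      g = ≈-sym (⊗-zeroʳ g)
⊗-comm (a ∷ f) g = ≈-trans (⊕-cong ≈-refl (∷-cong refl (⊗-comm f g))) (≈-sym (⊗-consʳ g a f))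

⊗-identityʳ : ∀ f → f ⊗ one ≈ f
⊗-identityʳ f = ≈-trans (⊗-comm f one) (⊗-identityˡ f)

⊗-assoc : ∀ f g h → (f ⊗ g) ⊗ h ≈ f ⊗ (g ⊗ h)
⊗-assoc []      g h = ≈-refl
⊗-assoc (a ∷ f) g h = begin
  (scale a g ⊕ (0ℤ ∷ f ⊗ g)) ⊗ h              ≈⟨ ⊗-distribʳ h (scale a g) (0ℤ ∷ f ⊗ g) ⟩
  (scale a g ⊗ h) ⊕ ((0ℤ ∷ f ⊗ g) ⊗ h)        ≈⟨ ⊕-cong (scale-⊗ˡ a g h) (⊗-shiftˡ (f ⊗ g) h) ⟩
  scale a (g ⊗ h) ⊕ (0ℤ ∷ (f ⊗ g) ⊗ h)        ≈⟨ ⊕-cong ≈-refl (∷-cong refl (⊗-assoc f g h)) ⟩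
  scale a (g ⊗ h) ⊕ (0ℤ ∷ f ⊗ (g ⊗ h))        ∎
  where open ≈-Reasoning

⊕-⊗-isCommutativeRing : IsCommutativeRing _≈_ _⊕_ _⊗_ neg [] one
⊕-⊗-isCommutativeRing = record
  { isRing = record
    { +-isAbelianGroup = record
      { isGroup = record
        { isMonoid = record
          { isSemigroup = CommutativeSemigroup.isSemigroup ⊕-commutativeSemigroup
          ; identity = (λ _ → ≈-refl) , ⊕-identityʳ }
        ; inverse = (λ f → ≈-trans (⊕-comm (neg f) f) (neg-inverseʳ f)) , neg-inverseʳ
        ; ⁻¹-cong = neg-cong }
      ; comm = ⊕-comm }
    ; *-cong = ⊗-cong
    ; *-assoc = ⊗-assoc
    ; *-identity = ⊗-identityˡ , ⊗-identityʳ
    ; distrib = ⊗-distribˡ , ⊗-distribʳ }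
  ; *-comm = ⊗-comm }

⊕-⊗-commutativeRing : CommutativeRing 0ℓ 0ℓ
⊕-⊗-commutativeRing = record { isCommutativeRing = ⊕-⊗-isCommutativeRing }

-- The solver only uses 0≟_ to drop zero terms, so it may always answer nothing.
polyRing : ACR.AlmostCommutativeRing 0ℓ 0ℓ
polyRing = ACR.fromCommutativeRing ⊕-⊗-commutativeRing (λ _ → nothing)

coeff-⊗-0 : ∀ f g → coeff (f ⊗ g) 0 ≡ coeff f 0 * coeff g 0
coeff-⊗-0 []      g = refl
coeff-⊗-0 (a ∷ f) g = trans (coeff-⊕ (scale a g) (0ℤ ∷ f ⊗ g) 0) (trans (ℤP.+-identityʳ _) (coeff-scale a g 0))

scale≈[_]⊗ : ∀ a f → scale a f ≈ (a ∷ []) ⊗ f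
scale≈[ a ]⊗ f = ≈-sym (≈-trans (⊕-cong ≈-refl [0]≈[]) (⊕-identityʳ (scale a f)))

-- Degree bounds and the reflection qⁿ f(q⁻¹)

Deg≤ : ℕ → Poly → Set
Deg≤ n f = length f ≤ suc n

coeff-beyond : ∀ f {i} → length f ≤ i → coeff f i ≡ 0ℤ
coeff-beyond []      _       = refl
coeff-beyond (a ∷ f) (s≤s p) = coeff-beyond f p

length-⊕ : ∀ {k} f g → length f ≤ k → length g ≤ k → length (f ⊕ g) ≤ k
length-⊕ []      g       _        q        = q
length-⊕ (a ∷ f) []      p        _        = p
length-⊕ (a ∷ f) (b ∷ g) (s≤s p) (s≤s q) = s≤s (length-⊕ f g p q)

length-scale : ∀ a f → length (scale a f) ≡ length f
length-scale a []      = refl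
length-scale a (b ∷ f) = cong suc (length-scale a f)

Deg≤-scale : ∀ {n} a f → Deg≤ n f → Deg≤ n (scale a f)
Deg≤-scale a f d rewrite length-scale a f = d

Deg≤-⊗ : ∀ m n f g → Deg≤ m f → Deg≤ n g → Deg≤ (m ℕ.+ n) (f ⊗ g)
Deg≤-⊗ m       n []           g _          _  = z≤n
Deg≤-⊗ zero    n (a ∷ [])     g _          dg = length-⊕ (scale a g) (0ℤ ∷ []) (Deg≤-scale a g dg) (s≤s z≤n)
Deg≤-⊗ zero    n (a ∷ _ ∷ _)  g (s≤s ())   _
Deg≤-⊗ (suc m) n (a ∷ f)      g (s≤s df)   dg = length-⊕ (scale a g) (0ℤ ∷ f ⊗ g)
  (ℕP.≤-trans (Deg≤-scale a g dg) (s≤s (ℕP.m≤n+m n (suc m))))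
  (s≤s (Deg≤-⊗ m n f g df dg))

++-[]≈ : ∀ g a → g ++ a ∷ [] ≈ g ⊕ scale a (qpow (length g))
++-[]≈ []      a = ∷-cong (sym (ℤP.*-identityʳ a)) ≈-refl
++-[]≈ (b ∷ g) a = ∷-cong (sym (trans (cong (λ z → b + z) (ℤP.*-zeroʳ a)) (ℤP.+-identityʳ b))) (++-[]≈ g a)

++-[]-cong : ∀ {g h} a → g ≈ h → length g ≡ length h → g ++ a ∷ [] ≈ h ++ a ∷ []
++-[]-cong {g} {h} a g≈h len≡ = begin
  g ++ a ∷ []                            ≈⟨ ++-[]≈ g a ⟩
  g ⊕ scale a (qpow (length g))          ≡⟨ cong (λ n → g ⊕ scale a (qpow n)) len≡ ⟩
  g ⊕ scale a (qpow (length h))          ≈⟨ ⊕-cong g≈h ≈-refl ⟩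
  h ⊕ scale a (qpow (length h))          ≈⟨ ++-[]≈ h a ⟨
  h ++ a ∷ []                            ∎
  where open ≈-Reasoning

-- reflect n f = qⁿ f(q⁻¹) for deg f ≤ n: the coefficients a₀ … aₙ in reverse order.
reflect : ℕ → Poly → Poly
reflect zero    f = coeff f 0 ∷ []
reflect (suc n) f = coeff f (suc n) ∷ reflect n f

length-reflect : ∀ n f → length (reflect n f) ≡ suc n
length-reflect zero    f = refl
length-reflect (suc n) f = cong suc (length-reflect n f)

reflect-cong : ∀ n {f g} → f ≈ g → reflect n f ≡ reflect n g
reflect-cong zero    p = cong (_∷ []) (coeff-≡ p 0)
reflect-cong (suc n) p = cong₂ _∷_ (coeff-≡ p (suc n)) (reflect-cong n p)

reflect-⊕ : ∀ n f g → reflect n (f ⊕ g) ≈ reflect n f ⊕ reflect n g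
reflect-⊕ zero    f g = ∷-cong (coeff-⊕ f g 0) ≈-refl
reflect-⊕ (suc n) f g = ∷-cong (coeff-⊕ f g (suc n)) (reflect-⊕ n f g)

reflect-scale : ∀ n a f → reflect n (scale a f) ≈ scale a (reflect n f)
reflect-scale zero    a f = ∷-cong (coeff-scale a f 0) ≈-refl
reflect-scale (suc n) a f = ∷-cong (coeff-scale a f (suc n)) (reflect-scale n a f)

reflect-[] : ∀ n → reflect n [] ≈ []
reflect-[] zero    = [0]≈[]
reflect-[] (suc n) = ≈-trans (∷-cong refl (reflect-[] n)) [0]≈[]

reflect-suc-∷ : ∀ n a f → reflect (suc n) (a ∷ f) ≡ reflect n f ++ a ∷ []
reflect-suc-∷ zero    a f = refl
reflect-suc-∷ (suc n) a f = cong (coeff f (suc n) ∷_) (reflect-suc-∷ n a f)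

reflect-suc-∷≈ : ∀ n a f → reflect (suc n) (a ∷ f) ≈ reflect n f ⊕ scale a (qpow (suc n))
reflect-suc-∷≈ n a f rewrite reflect-suc-∷ n a f =
  subst (λ k → reflect n f ++ a ∷ [] ≈ reflect n f ⊕ scale a (qpow k)) (length-reflect n f)
        (++-[]≈ (reflect n f) a)

reflect-shift : ∀ n f → reflect (suc n) (0ℤ ∷ f) ≈ reflect n f
reflect-shift n f = ≈-trans (reflect-suc-∷≈ n 0ℤ f)
  (≈-trans (⊕-cong ≈-refl (scale-zero (qpow (suc n)))) (⊕-identityʳ (reflect n f)))

reflect-pad : ∀ m n g → Deg≤ n g → reflect (m ℕ.+ n) g ≈ qpow m ⊗ reflect n g
reflect-pad zero    n g _ = ≈-sym (⊗-identityˡ (reflect n g))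
reflect-pad (suc m) n g d = ≈-trans
  (∷-cong (coeff-beyond g (ℕP.≤-trans d (s≤s (ℕP.m≤n+m n m)))) (reflect-pad m n g d))
  (≈-sym (⊗-shiftˡ (qpow m) (reflect n g)))

reflect-⊗ : ∀ m n f g → Deg≤ m f → Deg≤ n g →
            reflect (m ℕ.+ n) (f ⊗ g) ≈ reflect m f ⊗ reflect n g
reflect-⊗ m       n []      g _ _ =
  ≈-trans (reflect-[] (m ℕ.+ n)) (≈-sym (⊗-zeroˡ (reflect m []) (reflect n g) (reflect-[] m)))
reflect-⊗ zero    n (a ∷ []) g _ _ = begin
  reflect n (scale a g ⊕ (0ℤ ∷ []))  ≡⟨ reflect-cong n (⊕-cong ≈-refl [0]≈[]) ⟩
  reflect n (scale a g ⊕ [])         ≡⟨ reflect-cong n (⊕-identityʳ (scale a g)) ⟩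
  reflect n (scale a g)              ≈⟨ reflect-scale n a g ⟩
  scale a (reflect n g)              ≈⟨ scale≈[ a ]⊗ (reflect n g) ⟩
  (a ∷ []) ⊗ reflect n g             ∎
  where open ≈-Reasoning
reflect-⊗ zero    n (a ∷ _ ∷ _) g (s≤s ()) _
reflect-⊗ (suc m) n (a ∷ f) g (s≤s df) dg = begin
  reflect (suc m ℕ.+ n) (scale a g ⊕ (0ℤ ∷ f ⊗ g))
    ≈⟨ reflect-⊕ (suc m ℕ.+ n) (scale a g) (0ℤ ∷ f ⊗ g) ⟩
  reflect (suc m ℕ.+ n) (scale a g) ⊕ reflect (suc m ℕ.+ n) (0ℤ ∷ f ⊗ g)
    ≈⟨ ⊕-cong (reflect-scale (suc m ℕ.+ n) a g) (reflect-shift (m ℕ.+ n) (f ⊗ g)) ⟩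
  scale a (reflect (suc m ℕ.+ n) g) ⊕ reflect (m ℕ.+ n) (f ⊗ g)
    ≈⟨ ⊕-cong (≈-trans (scale≈[ a ]⊗ _) (⊗-congʳ (a ∷ []) (reflect-pad (suc m) n g dg))) (reflect-⊗ m n f g df dg) ⟩
  (a ∷ []) ⊗ (qpow (suc m) ⊗ G) ⊕ reflect m f ⊗ G
    ≈⟨ rearrange (a ∷ []) (qpow (suc m)) (reflect m f) G ⟩
  (reflect m f ⊕ (a ∷ []) ⊗ qpow (suc m)) ⊗ G
    ≈⟨ ⊗-congˡ G (⊕-cong (≈-refl {reflect m f}) (scale≈[ a ]⊗ (qpow (suc m)))) ⟨
  (reflect m f ⊕ scale a (qpow (suc m))) ⊗ G
    ≈⟨ ⊗-congˡ G (reflect-suc-∷≈ m a f) ⟨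
  reflect (suc m) (a ∷ f) ⊗ G
    ∎
  where
  open ≈-Reasoning
  G = reflect n g
  rearrange : ∀ c p x y → c ⊗ (p ⊗ y) ⊕ x ⊗ y ≈ (x ⊕ c ⊗ p) ⊗ y
  rearrange = ring-solve polyRing

coeff-reflect-top : ∀ n f → coeff (reflect n f) n ≡ coeff f 0
coeff-reflect-top zero    f = refl
coeff-reflect-top (suc n) f = coeff-reflect-top n f

reverse≈reflect : ∀ a t → reverse (a ∷ t) ≈ reflect (length t) (a ∷ t)
reverse≈reflect a []      = ≈-refl
reverse≈reflect a (b ∷ t) = begin
  reverse (a ∷ b ∷ t)                       ≡⟨ LP.unfold-reverse a (b ∷ t) ⟩
  reverse (b ∷ t) ++ a ∷ []                 ≈⟨ ++-[]-cong a (reverse≈reflect b t) length≡ ⟩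
  reflect (length t) (b ∷ t) ++ a ∷ []      ≡⟨ reflect-suc-∷ (length t) a (b ∷ t) ⟨
  reflect (length (b ∷ t)) (a ∷ b ∷ t)      ∎
  where
  open ≈-Reasoning
  length≡ : length (reverse (b ∷ t)) ≡ length (reflect (length t) (b ∷ t))
  length≡ = trans (LP.length-reverse (b ∷ t)) (sym (length-reflect (length t) (b ∷ t)))

-- Trimmed polynomials

data Trimmed : Poly → Set where
  empty  : Trimmed []
  single : ∀ {a} → a ≢ 0ℤ → Trimmed (a ∷ [])
  cons   : ∀ a {b f} → Trimmed (b ∷ f) → Trimmed (a ∷ b ∷ f)

trim-trimmed : ∀ f → Trimmed (trim f)
trim-trimmed []      = empty
trim-trimmed (a ∷ f) with trim f | trim-trimmed f
... | _ ∷ _ | t = cons a t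
... | []    | _ with a ℤ.≟ 0ℤ
...   | yes _   = empty
...   | no a≢0  = single a≢0

trim-≈ : ∀ f → trim f ≈ f
trim-≈ []      = ≈-refl
trim-≈ (a ∷ f) with trim f | trim-≈ f
... | _ ∷ _ | t≈f = ∷-cong refl t≈f
... | []    | t≈f with a ℤ.≟ 0ℤ
...   | yes a≡0 = ≈-sym (≈-trans (∷-cong a≡0 (≈-sym t≈f)) [0]≈[])
...   | no _    = ∷-cong refl t≈f

trimmed-≈[] : ∀ {f} → Trimmed f → f ≈ [] → f ≡ []
trimmed-≈[] empty      _ = refl
trimmed-≈[] (single a≢0) p = ⊥-elim (a≢0 (coeff-≡ p 0))
trimmed-≈[] (cons a t) p with () ← trimmed-≈[] t (∷-[] p)

trimmed-≈⇒≡ : ∀ {f g} → Trimmed f → Trimmed g → f ≈ g → f ≡ g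
trimmed-≈⇒≡ empty          tg             p = sym (trimmed-≈[] tg (≈-sym p))
trimmed-≈⇒≡ tf             empty          p = trimmed-≈[] tf p
trimmed-≈⇒≡ (single _)     (single _)     p = cong (_∷ []) (coeff-≡ p 0)
trimmed-≈⇒≡ (single _)     (cons _ t)     p with () ← trimmed-≈[] t (≈-sym (∷-injective p))
trimmed-≈⇒≡ (cons _ t)     (single _)     p with () ← trimmed-≈[] t (∷-injective p)
trimmed-≈⇒≡ (cons _ t)     (cons _ t′)    p = cong₂ _∷_ (coeff-≡ p 0) (trimmed-≈⇒≡ t t′ (∷-injective p))

trim-cong : ∀ {f g} → f ≈ g → trim f ≡ trim g
trim-cong {f} {g} p = trimmed-≈⇒≡ (trim-trimmed f) (trim-trimmed g) (≈-trans (trim-≈ f) (≈-trans p (≈-sym (trim-≈ g))))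

trimmed-++-[] : ∀ g {a} → a ≢ 0ℤ → Trimmed (g ++ a ∷ [])
trimmed-++-[] []          a≢0 = single a≢0
trimmed-++-[] (b ∷ [])    a≢0 = cons b (single a≢0)
trimmed-++-[] (b ∷ c ∷ g) a≢0 = cons b (trimmed-++-[] (c ∷ g) a≢0)

trimmed-last : ∀ {a t} → Trimmed (a ∷ t) → coeff (a ∷ t) (length t) ≢ 0ℤ
trimmed-last (single a≢0) = a≢0
trimmed-last (cons _ t)   = trimmed-last t

trimmed-length : ∀ {a t x} n → Trimmed (a ∷ t) → a ∷ t ≈ x → Deg≤ n x → coeff x n ≢ 0ℤ → length t ≡ n
trimmed-length {a} {t} {x} n tt t≈x deg xₙ≢0 = ℕP.≤-antisym ≤n n≤
  where
  ≤n : length t ≤ n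
  ≤n with length t ℕP.≤? n
  ... | yes ≤n = ≤n
  ... | no  ≰n = ⊥-elim (trimmed-last tt (trans (coeff-≡ t≈x (length t)) (coeff-beyond x (ℕP.≤-trans deg (ℕP.≰⇒> ≰n)))))
  n≤ : n ≤ length t
  n≤ with suc (length t) ℕP.≤? n
  ... | yes >t = ⊥-elim (xₙ≢0 (trans (sym (coeff-≡ t≈x n)) (coeff-beyond (a ∷ t) >t)))
  ... | no  ≯t = ℕP.≤-pred (ℕP.≰⇒> ≯t)

reflection-fixed⇒palindrome : ∀ {t x} n → Trimmed t → t ≈ x → Deg≤ n x → coeff x 0 ≡ 1ℤ → reflect n x ≈ x → reverse t ≡ t
reflection-fixed⇒palindrome n empty t≈x _ x₀≡1 _ with () ← trans (sym x₀≡1) (sym (coeff-≡ t≈x 0))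
reflection-fixed⇒palindrome {a ∷ t} {x} n tt t≈x deg x₀≡1 fixed = trimmed-≈⇒≡ trimmed-rev tt rev≈
  where
  1≢0 : 1ℤ ≢ 0ℤ
  1≢0 ()
  a≡1 : a ≡ 1ℤ
  a≡1 = trans (coeff-≡ t≈x 0) x₀≡1
  xₙ≡1 : coeff x n ≡ 1ℤ
  xₙ≡1 = trans (sym (coeff-≡ fixed n)) (trans (coeff-reflect-top n x) x₀≡1)
  length≡ : length t ≡ n
  length≡ = trimmed-length n tt t≈x deg (λ xₙ≡0 → 1≢0 (trans (sym xₙ≡1) xₙ≡0))
  rev≈ : reverse (a ∷ t) ≈ a ∷ t
  rev≈ = begin
    reverse (a ∷ t)                ≈⟨ reverse≈reflect a t ⟩
    reflect (length t) (a ∷ t)     ≡⟨ cong (λ m → reflect m (a ∷ t)) length≡ ⟩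
    reflect n (a ∷ t)              ≡⟨ reflect-cong n t≈x ⟩
    reflect n x                    ≈⟨ fixed ⟩
    x                              ≈⟨ t≈x ⟨
    a ∷ t                          ∎
    where open ≈-Reasoning
  trimmed-rev : Trimmed (reverse (a ∷ t))
  trimmed-rev = subst Trimmed (sym (LP.unfold-reverse a t)) (trimmed-++-[] (reverse t) (λ a≡0 → 1≢0 (trans (sym a≡1) a≡0)))

-- The matrices M⁻(c) and their products

record Mat : Set where
  constructor mat
  field e₁₁ e₁₂ e₂₁ e₂₂ : Poly
open Mat public

infix 4 _≈ₘ_
record _≈ₘ_ (A B : Mat) : Set where
  constructor mk≈ₘ
  field
    ≈₁₁ : e₁₁ A ≈ e₁₁ B
    ≈₁₂ : e₁₂ A ≈ e₁₂ B
    ≈₂₁ : e₂₁ A ≈ e₂₁ B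
    ≈₂₂ : e₂₂ A ≈ e₂₂ B
open _≈ₘ_ public

≈ₘ-setoid : Setoid 0ℓ 0ℓ
≈ₘ-setoid = record
  { Carrier = Mat
  ; _≈_ = _≈ₘ_
  ; isEquivalence = record
    { refl  = mk≈ₘ ≈-refl ≈-refl ≈-refl ≈-refl
    ; sym   = λ p → mk≈ₘ (≈-sym (≈₁₁ p)) (≈-sym (≈₁₂ p)) (≈-sym (≈₂₁ p)) (≈-sym (≈₂₂ p))
    ; trans = λ p q → mk≈ₘ (≈-trans (≈₁₁ p) (≈₁₁ q)) (≈-trans (≈₁₂ p) (≈₁₂ q))
                           (≈-trans (≈₂₁ p) (≈₂₁ q)) (≈-trans (≈₂₂ p) (≈₂₂ q)) } }

open Setoid ≈ₘ-setoid public using () renaming (refl to ≈ₘ-refl; sym to ≈ₘ-sym; trans to ≈ₘ-trans)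
module ≈ₘ-Reasoning = SetoidReasoning ≈ₘ-setoid

infixl 7 _·_
_·_ : Mat → Mat → Mat
mat a b c d · mat p q r s = mat (a ⊗ p ⊕ b ⊗ r) (a ⊗ q ⊕ b ⊗ s) (c ⊗ p ⊕ d ⊗ r) (c ⊗ q ⊕ d ⊗ s)

I₂ : Mat
I₂ = mat one [] [] one

·-cong : ∀ {A A′ B B′} → A ≈ₘ A′ → B ≈ₘ B′ → A · B ≈ₘ A′ · B′
·-cong {mat _ _ _ _} {mat _ _ _ _} {mat _ _ _ _} {mat _ _ _ _} p q = mk≈ₘ
  (⊕-cong (⊗-cong (≈₁₁ p) (≈₁₁ q)) (⊗-cong (≈₁₂ p) (≈₂₁ q)))
  (⊕-cong (⊗-cong (≈₁₁ p) (≈₁₂ q)) (⊗-cong (≈₁₂ p) (≈₂₂ q)))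
  (⊕-cong (⊗-cong (≈₂₁ p) (≈₁₁ q)) (⊗-cong (≈₂₂ p) (≈₂₁ q)))
  (⊕-cong (⊗-cong (≈₂₁ p) (≈₁₂ q)) (⊗-cong (≈₂₂ p) (≈₂₂ q)))

·-assoc : ∀ A B C → (A · B) · C ≈ₘ A · (B · C)
·-assoc (mat a₁ a₂ a₃ a₄) (mat b₁ b₂ b₃ b₄) (mat c₁ c₂ c₃ c₄) = mk≈ₘ
  (entry a₁ a₂ b₁ b₂ b₃ b₄ c₁ c₃) (entry a₁ a₂ b₁ b₂ b₃ b₄ c₂ c₄)
  (entry a₃ a₄ b₁ b₂ b₃ b₄ c₁ c₃) (entry a₃ a₄ b₁ b₂ b₃ b₄ c₂ c₄)
  where
  entry : ∀ x y b₁ b₂ b₃ b₄ z w →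
          (x ⊗ b₁ ⊕ y ⊗ b₃) ⊗ z ⊕ (x ⊗ b₂ ⊕ y ⊗ b₄) ⊗ w ≈ x ⊗ (b₁ ⊗ z ⊕ b₂ ⊗ w) ⊕ y ⊗ (b₃ ⊗ z ⊕ b₄ ⊗ w)
  entry = ring-solve polyRing

·-identityˡ : ∀ A → I₂ · A ≈ₘ A
·-identityˡ (mat a b c d) = mk≈ₘ
  (≈-trans (⊕-identityʳ (one ⊗ a)) (⊗-identityˡ a)) (≈-trans (⊕-identityʳ (one ⊗ b)) (⊗-identityˡ b))
  (⊗-identityˡ c) (⊗-identityˡ d)

·-identityʳ : ∀ A → A · I₂ ≈ₘ A
·-identityʳ (mat a b c d) = mk≈ₘ (idˡ a b) (idʳ a b) (idˡ c d) (idʳ c d)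
  where
  idˡ : ∀ x y → x ⊗ one ⊕ y ⊗ [] ≈ x
  idˡ x y = ≈-trans (⊕-cong (⊗-identityʳ x) (⊗-zeroʳ y)) (⊕-identityʳ x)
  idʳ : ∀ x y → x ⊗ [] ⊕ y ⊗ one ≈ y
  idʳ x y = ⊕-cong (⊗-zeroʳ x) (⊗-identityʳ y)

M⁻ : ℕ → Mat
M⁻ c = mat (qint c) (neg (qpowPred c)) one []

prod : List ℕ → Mat
prod []       = I₂
prod (c ∷ cs) = M⁻ c · prod cs

prod-++-[] : ∀ cs c → prod (cs ++ c ∷ []) ≈ₘ prod cs · M⁻ c
prod-++-[] []       c = ≈ₘ-trans (·-identityʳ (M⁻ c)) (≈ₘ-sym (·-identityˡ (M⁻ c)))
prod-++-[] (d ∷ cs) c = ≈ₘ-trans (·-cong (≈ₘ-refl {M⁻ d}) (prod-++-[] cs c)) (≈ₘ-sym (·-assoc (M⁻ d) (prod cs) (M⁻ c)))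

MprodList≈prod : ∀ cs → PolyPair.fst (MprodList cs) ≈ e₁₁ (prod cs) × PolyPair.snd (MprodList cs) ≈ e₂₁ (prod cs)
MprodList≈prod []       = ≈-refl , ≈-refl
MprodList≈prod (c ∷ cs) with MprodList≈prod cs
... | x≈ , y≈ =
  ≈-trans (⊕-cong (⊗-congʳ (qint c) x≈) (neg-cong (⊗-congʳ (qpowPred c) y≈))) (neg-⊗ˡ (qint c ⊗ _) (qpowPred c) _) ,
  ≈-trans x≈ (≈-sym (≈-trans (⊕-identityʳ (one ⊗ _)) (⊗-identityˡ _)))
  where
  neg-⊗ˡ : ∀ z a y → z ⊕ neg (a ⊗ y) ≈ z ⊕ neg a ⊗ y
  neg-⊗ˡ = ring-solve polyRing

-- D Aᵀ D with D = diag(1, −1).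
twistT : Mat → Mat
twistT (mat a b c d) = mat a (neg c) (neg b) d

twistT-cong : ∀ {A B} → A ≈ₘ B → twistT A ≈ₘ twistT B
twistT-cong {mat _ _ _ _} {mat _ _ _ _} p = mk≈ₘ (≈₁₁ p) (neg-cong (≈₂₁ p)) (neg-cong (≈₁₂ p)) (≈₂₂ p)

twistT-· : ∀ A B → twistT (A · B) ≈ₘ twistT B · twistT A
twistT-· (mat a b c d) (mat p q r s) = mk≈ₘ (t₁₁ a b p r) (t₁₂ c d p r) (t₂₁ a b q s) (t₂₂ c d q s)
  where
  t₁₁ : ∀ a b p r → a ⊗ p ⊕ b ⊗ r ≈ p ⊗ a ⊕ neg r ⊗ neg b
  t₁₁ = ring-solve polyRing
  t₁₂ : ∀ c d p r → neg (c ⊗ p ⊕ d ⊗ r) ≈ p ⊗ neg c ⊕ neg r ⊗ d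
  t₁₂ = ring-solve polyRing
  t₂₁ : ∀ a b q s → neg (a ⊗ q ⊕ b ⊗ s) ≈ neg q ⊗ a ⊕ s ⊗ neg b
  t₂₁ = ring-solve polyRing
  t₂₂ : ∀ c d q s → c ⊗ q ⊕ d ⊗ s ≈ neg q ⊗ neg c ⊕ s ⊗ d
  t₂₂ = ring-solve polyRing

reflectₘ : ℕ → Mat → Mat
reflectₘ n (mat a b c d) = mat (reflect n a) (reflect n b) (reflect n c) (reflect n d)

record Deg≤ₘ (n : ℕ) (A : Mat) : Set where
  constructor mkDeg≤ₘ
  field
    deg₁₁ : Deg≤ n (e₁₁ A)
    deg₁₂ : Deg≤ n (e₁₂ A)
    deg₂₁ : Deg≤ n (e₂₁ A)
    deg₂₂ : Deg≤ n (e₂₂ A)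
open Deg≤ₘ public

Deg≤ₘ-· : ∀ m n A B → Deg≤ₘ m A → Deg≤ₘ n B → Deg≤ₘ (m ℕ.+ n) (A · B)
Deg≤ₘ-· m n (mat a b c d) (mat p q r s) dA dB = mkDeg≤ₘ
  (entry a b p r (deg₁₁ dA) (deg₁₂ dA) (deg₁₁ dB) (deg₂₁ dB)) (entry a b q s (deg₁₁ dA) (deg₁₂ dA) (deg₁₂ dB) (deg₂₂ dB))
  (entry c d p r (deg₂₁ dA) (deg₂₂ dA) (deg₁₁ dB) (deg₂₁ dB)) (entry c d q s (deg₂₁ dA) (deg₂₂ dA) (deg₁₂ dB) (deg₂₂ dB))
  where
  entry : ∀ x y z w → Deg≤ m x → Deg≤ m y → Deg≤ n z → Deg≤ n w → Deg≤ (m ℕ.+ n) (x ⊗ z ⊕ y ⊗ w)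
  entry x y z w dx dy dz dw = length-⊕ (x ⊗ z) (y ⊗ w) (Deg≤-⊗ m n x z dx dz) (Deg≤-⊗ m n y w dy dw)

reflectₘ-· : ∀ m n A B → Deg≤ₘ m A → Deg≤ₘ n B → reflectₘ (m ℕ.+ n) (A · B) ≈ₘ reflectₘ m A · reflectₘ n B
reflectₘ-· m n (mat a b c d) (mat p q r s) dA dB = mk≈ₘ
  (entry a b p r (deg₁₁ dA) (deg₁₂ dA) (deg₁₁ dB) (deg₂₁ dB)) (entry a b q s (deg₁₁ dA) (deg₁₂ dA) (deg₁₂ dB) (deg₂₂ dB))
  (entry c d p r (deg₂₁ dA) (deg₂₂ dA) (deg₁₁ dB) (deg₂₁ dB)) (entry c d q s (deg₂₁ dA) (deg₂₂ dA) (deg₁₂ dB) (deg₂₂ dB))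
  where
  entry : ∀ x y z w → Deg≤ m x → Deg≤ m y → Deg≤ n z → Deg≤ n w →
          reflect (m ℕ.+ n) (x ⊗ z ⊕ y ⊗ w) ≈ reflect m x ⊗ reflect n z ⊕ reflect m y ⊗ reflect n w
  entry x y z w dx dy dz dw = ≈-trans (reflect-⊕ (m ℕ.+ n) (x ⊗ z) (y ⊗ w))
    (⊕-cong (reflect-⊗ m n x z dx dz) (reflect-⊗ m n y w dy dw))

totalDegree : List ℕ → ℕ
totalDegree []       = 0
totalDegree (c ∷ cs) = ℕ.pred c ℕ.+ totalDegree cs

length-qint : ∀ c → length (qint c) ≡ c
length-qint zero    = refl
length-qint (suc c) = cong suc (length-qint c)

length-qpow : ∀ c → length (qpow c) ≡ suc c
length-qpow zero    = refl
length-qpow (suc c) = cong suc (length-qpow c)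

Deg≤ₘ-M⁻ : ∀ c → Deg≤ₘ (ℕ.pred c) (M⁻ c)
Deg≤ₘ-M⁻ zero    = mkDeg≤ₘ z≤n z≤n (s≤s z≤n) z≤n
Deg≤ₘ-M⁻ (suc c) = mkDeg≤ₘ (ℕP.≤-reflexive (length-qint (suc c)))
  (Deg≤-scale (- 1ℤ) (qpow c) (ℕP.≤-reflexive (length-qpow c))) (s≤s z≤n) z≤n

Deg≤ₘ-prod : ∀ cs → Deg≤ₘ (totalDegree cs) (prod cs)
Deg≤ₘ-prod []       = mkDeg≤ₘ (s≤s z≤n) z≤n z≤n (s≤s z≤n)
Deg≤ₘ-prod (c ∷ cs) = Deg≤ₘ-· (ℕ.pred c) (totalDegree cs) (M⁻ c) (prod cs) (Deg≤ₘ-M⁻ c) (Deg≤ₘ-prod cs)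

qint-++-[] : ∀ n → qint n ++ 1ℤ ∷ [] ≡ 1ℤ ∷ qint n
qint-++-[] zero    = refl
qint-++-[] (suc n) = cong (1ℤ ∷_) (qint-++-[] n)

reflect-qint : ∀ n → reflect n (qint (suc n)) ≡ qint (suc n)
reflect-qint zero    = refl
reflect-qint (suc n) = begin
  reflect (suc n) (1ℤ ∷ qint (suc n))   ≡⟨ reflect-suc-∷ n 1ℤ (qint (suc n)) ⟩
  reflect n (qint (suc n)) ++ 1ℤ ∷ []   ≡⟨ cong (_++ 1ℤ ∷ []) (reflect-qint n) ⟩
  qint (suc n) ++ 1ℤ ∷ []               ≡⟨ qint-++-[] (suc n) ⟩
  1ℤ ∷ qint (suc n)                     ∎
  where open ≡-Reasoning

reflect-qpow : ∀ n → reflect n (qpow n) ≈ one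
reflect-qpow zero    = ≈-refl
reflect-qpow (suc n) = ≈-trans (reflect-shift n (qpow n)) (reflect-qpow n)

reflect-one : ∀ n → reflect n one ≡ qpow n
reflect-one zero    = refl
reflect-one (suc n) = cong (0ℤ ∷_) (reflect-one n)

reflectₘ-M⁻ : ∀ c → reflectₘ c (M⁻ (suc c)) ≈ₘ twistT (M⁻ (suc c))
reflectₘ-M⁻ c = mk≈ₘ
  (≈-reflexive (reflect-qint c))
  (≈-trans (reflect-scale c (- 1ℤ) (qpow c)) (neg-cong (reflect-qpow c)))
  (≈-trans (≈-reflexive (reflect-one c)) (neg-involutive (qpow c)))
  (reflect-[] c)
  where
  neg-involutive : ∀ x → x ≈ neg (neg x)
  neg-involutive = ring-solve polyRing

reflectₘ-prod : ∀ cs → All (1 ≤_) cs → reflectₘ (totalDegree cs) (prod cs) ≈ₘ twistT (prod (reverse cs))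
reflectₘ-prod []             []          = mk≈ₘ ≈-refl [0]≈[] [0]≈[] ≈-refl
reflectₘ-prod (suc c ∷ cs) (s≤s _ ∷ 1≤cs) = begin
  reflectₘ (c ℕ.+ totalDegree cs) (M⁻ (suc c) · prod cs)
    ≈⟨ reflectₘ-· c (totalDegree cs) (M⁻ (suc c)) (prod cs) (Deg≤ₘ-M⁻ (suc c)) (Deg≤ₘ-prod cs) ⟩
  reflectₘ c (M⁻ (suc c)) · reflectₘ (totalDegree cs) (prod cs)
    ≈⟨ ·-cong (reflectₘ-M⁻ c) (reflectₘ-prod cs 1≤cs) ⟩
  twistT (M⁻ (suc c)) · twistT (prod (reverse cs))
    ≈⟨ twistT-· (prod (reverse cs)) (M⁻ (suc c)) ⟨
  twistT (prod (reverse cs) · M⁻ (suc c))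
    ≈⟨ twistT-cong (prod-++-[] (reverse cs) (suc c)) ⟨
  twistT (prod (reverse cs ++ suc c ∷ []))
    ≡⟨ cong (twistT ∘ prod) (LP.unfold-reverse (suc c) cs) ⟨
  twistT (prod (reverse (suc c ∷ cs)))
    ∎
  where open ≈ₘ-Reasoning

-- Value and derivative at q = 1

ev₁ : Poly → ℤ
ev₁ []      = 0ℤ
ev₁ (a ∷ f) = a + ev₁ f

-- ev₁′ f = f′(1) = Σ i·aᵢ, from (a + q·g)′(1) = g(1) + g′(1).
ev₁′ : Poly → ℤ
ev₁′ []      = 0ℤ
ev₁′ (a ∷ f) = ev₁′ f + ev₁ f

ev₁-≈[] : ∀ {f} → f ≈ [] → ev₁ f ≡ 0ℤ
ev₁-≈[] {[]}    p = refl
ev₁-≈[] {a ∷ f} p = cong₂ _+_ (coeff-≡ p 0) (ev₁-≈[] (∷-[] p))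

ev₁′-≈[] : ∀ {f} → f ≈ [] → ev₁′ f ≡ 0ℤ
ev₁′-≈[] {[]}    p = refl
ev₁′-≈[] {a ∷ f} p = cong₂ _+_ (ev₁′-≈[] (∷-[] p)) (ev₁-≈[] (∷-[] p))

ev₁-cong : ∀ {f g} → f ≈ g → ev₁ f ≡ ev₁ g
ev₁-cong {[]}    {g}     p = sym (ev₁-≈[] (≈-sym p))
ev₁-cong {a ∷ f} {[]}    p = ev₁-≈[] p
ev₁-cong {a ∷ f} {b ∷ g} p = cong₂ _+_ (coeff-≡ p 0) (ev₁-cong (∷-injective p))

ev₁′-cong : ∀ {f g} → f ≈ g → ev₁′ f ≡ ev₁′ g
ev₁′-cong {[]}    {g}     p = sym (ev₁′-≈[] (≈-sym p))
ev₁′-cong {a ∷ f} {[]}    p = ev₁′-≈[] p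
ev₁′-cong {a ∷ f} {b ∷ g} p = cong₂ _+_ (ev₁′-cong (∷-injective p)) (ev₁-cong (∷-injective p))

ev₁-⊕ : ∀ f g → ev₁ (f ⊕ g) ≡ ev₁ f + ev₁ g
ev₁-⊕ []      g       = sym (ℤP.+-identityˡ (ev₁ g))
ev₁-⊕ (a ∷ f) []      = sym (ℤP.+-identityʳ (ev₁ (a ∷ f)))
ev₁-⊕ (a ∷ f) (b ∷ g) = trans (cong (λ z → a + b + z) (ev₁-⊕ f g)) (shuffle a b (ev₁ f) (ev₁ g))
  where
  shuffle : ∀ a b x y → a + b + (x + y) ≡ a + x + (b + y)
  shuffle = solve-∀

ev₁-scale : ∀ a f → ev₁ (scale a f) ≡ a * ev₁ f
ev₁-scale a []      = sym (ℤP.*-zeroʳ a)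
ev₁-scale a (b ∷ f) = trans (cong (λ z → a * b + z) (ev₁-scale a f)) (sym (ℤP.*-distribˡ-+ a b (ev₁ f)))

ev₁-⊗ : ∀ f g → ev₁ (f ⊗ g) ≡ ev₁ f * ev₁ g
ev₁-⊗ []      g = refl
ev₁-⊗ (a ∷ f) g = begin
  ev₁ (scale a g ⊕ (0ℤ ∷ f ⊗ g))       ≡⟨ ev₁-⊕ (scale a g) (0ℤ ∷ f ⊗ g) ⟩
  ev₁ (scale a g) + (0ℤ + ev₁ (f ⊗ g)) ≡⟨ cong₂ (λ x y → x + (0ℤ + y)) (ev₁-scale a g) (ev₁-⊗ f g) ⟩
  a * ev₁ g + (0ℤ + ev₁ f * ev₁ g)     ≡⟨ collect a (ev₁ f) (ev₁ g) ⟩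
  (a + ev₁ f) * ev₁ g                  ∎
  where
  open ≡-Reasoning
  collect : ∀ a x y → a * y + (0ℤ + x * y) ≡ (a + x) * y
  collect = solve-∀

ev₁′-⊕ : ∀ f g → ev₁′ (f ⊕ g) ≡ ev₁′ f + ev₁′ g
ev₁′-⊕ []      g       = sym (ℤP.+-identityˡ (ev₁′ g))
ev₁′-⊕ (a ∷ f) []      = sym (ℤP.+-identityʳ (ev₁′ (a ∷ f)))
ev₁′-⊕ (a ∷ f) (b ∷ g) = trans (cong₂ _+_ (ev₁′-⊕ f g) (ev₁-⊕ f g)) (shuffle (ev₁′ f) (ev₁′ g) (ev₁ f) (ev₁ g))
  where
  shuffle : ∀ a b x y → a + b + (x + y) ≡ a + x + (b + y)
  shuffle = solve-∀

ev₁′-scale : ∀ a f → ev₁′ (scale a f) ≡ a * ev₁′ f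
ev₁′-scale a []      = sym (ℤP.*-zeroʳ a)
ev₁′-scale a (b ∷ f) = trans (cong₂ _+_ (ev₁′-scale a f) (ev₁-scale a f)) (sym (ℤP.*-distribˡ-+ a (ev₁′ f) (ev₁ f)))

ev₁′-⊗ : ∀ f g → ev₁′ (f ⊗ g) ≡ ev₁′ f * ev₁ g + ev₁ f * ev₁′ g
ev₁′-⊗ []      g = refl
ev₁′-⊗ (a ∷ f) g = begin
  ev₁′ (scale a g ⊕ (0ℤ ∷ f ⊗ g))
    ≡⟨ ev₁′-⊕ (scale a g) (0ℤ ∷ f ⊗ g) ⟩
  ev₁′ (scale a g) + (ev₁′ (f ⊗ g) + ev₁ (f ⊗ g))
    ≡⟨ cong₂ _+_ (ev₁′-scale a g) (cong₂ _+_ (ev₁′-⊗ f g) (ev₁-⊗ f g)) ⟩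
  a * ev₁′ g + ((ev₁′ f * ev₁ g + ev₁ f * ev₁′ g) + ev₁ f * ev₁ g)
    ≡⟨ collect a (ev₁′ f) (ev₁ f) (ev₁′ g) (ev₁ g) ⟩
  (ev₁′ f + ev₁ f) * ev₁ g + (a + ev₁ f) * ev₁′ g
    ∎
  where
  open ≡-Reasoning
  collect : ∀ a f′ f g′ g → a * g′ + ((f′ * g + f * g′) + f * g) ≡ (f′ + f) * g + (a + f) * g′
  collect = solve-∀

ev₁-++-[] : ∀ l x → ev₁ (l ++ x ∷ []) ≡ ev₁ l + x
ev₁-++-[] []      x = trans (ℤP.+-identityʳ x) (sym (ℤP.+-identityˡ x))
ev₁-++-[] (a ∷ l) x = trans (cong (λ z → a + z) (ev₁-++-[] l x)) (sym (ℤP.+-assoc a (ev₁ l) x))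

ev₁′-++-[] : ∀ l x → ev₁′ (l ++ x ∷ []) ≡ ev₁′ l + + length l * x
ev₁′-++-[] []      x = refl
ev₁′-++-[] (a ∷ l) x = begin
  ev₁′ (l ++ x ∷ []) + ev₁ (l ++ x ∷ [])          ≡⟨ cong₂ _+_ (ev₁′-++-[] l x) (ev₁-++-[] l x) ⟩
  ev₁′ l + + length l * x + (ev₁ l + x)           ≡⟨ regroup (ev₁′ l) (+ length l) x (ev₁ l) ⟩
  ev₁′ l + ev₁ l + (1ℤ + + length l) * x          ≡⟨ cong (λ n → ev₁′ l + ev₁ l + n * x) (ℤP.pos-+ 1 (length l)) ⟨
  ev₁′ l + ev₁ l + + length (a ∷ l) * x           ∎
  where
  open ≡-Reasoning
  regroup : ∀ w n x e → w + n * x + (e + x) ≡ w + e + (1ℤ + n) * x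
  regroup = solve-∀

ev₁′-reverse : ∀ l → ev₁′ (reverse l) + ev₁′ l ≡ (+ length l - 1ℤ) * ev₁ l
ev₁′-reverse []      = refl
ev₁′-reverse (a ∷ l) = begin
  ev₁′ (reverse (a ∷ l)) + (ev₁′ l + ev₁ l)
    ≡⟨ cong (λ z → ev₁′ z + (ev₁′ l + ev₁ l)) (LP.unfold-reverse a l) ⟩
  ev₁′ (reverse l ++ a ∷ []) + (ev₁′ l + ev₁ l)
    ≡⟨ cong (_+ (ev₁′ l + ev₁ l)) (ev₁′-++-[] (reverse l) a) ⟩
  ev₁′ (reverse l) + + length (reverse l) * a + (ev₁′ l + ev₁ l)
    ≡⟨ cong (λ n → ev₁′ (reverse l) + + n * a + (ev₁′ l + ev₁ l)) (LP.length-reverse l) ⟩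
  ev₁′ (reverse l) + + length l * a + (ev₁′ l + ev₁ l)
    ≡⟨ regroup (ev₁′ (reverse l)) (+ length l) a (ev₁′ l) (ev₁ l) ⟩
  (ev₁′ (reverse l) + ev₁′ l) + + length l * a + ev₁ l
    ≡⟨ cong (λ z → z + + length l * a + ev₁ l) (ev₁′-reverse l) ⟩
  (+ length l - 1ℤ) * ev₁ l + + length l * a + ev₁ l
    ≡⟨ collect (+ length l) a (ev₁ l) ⟩
  (1ℤ + + length l - 1ℤ) * (a + ev₁ l)
    ≡⟨ cong (λ n → (n - 1ℤ) * (a + ev₁ l)) (ℤP.pos-+ 1 (length l)) ⟨
  (+ length (a ∷ l) - 1ℤ) * ev₁ (a ∷ l)
    ∎
  where
  open ≡-Reasoning
  regroup : ∀ r n a w e → r + n * a + (w + e) ≡ r + w + n * a + e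
  regroup = solve-∀
  collect : ∀ n a e → (n - 1ℤ) * e + n * a + e ≡ (1ℤ + n - 1ℤ) * (a + e)
  collect = solve-∀

palindromic⇒2ev₁′ : ∀ f → Palindromic f → ev₁′ f + ev₁′ f ≡ (+ length (trim f) - 1ℤ) * ev₁ f
palindromic⇒2ev₁′ f pal = begin
  ev₁′ f + ev₁′ f                        ≡⟨ cong₂ _+_ (ev₁′-cong (trim-≈ f)) (ev₁′-cong (trim-≈ f)) ⟨
  ev₁′ t + ev₁′ t                        ≡⟨ cong (λ l → ev₁′ l + ev₁′ t) pal ⟨
  ev₁′ (reverse t) + ev₁′ t              ≡⟨ ev₁′-reverse t ⟩
  (+ length t - 1ℤ) * ev₁ t              ≡⟨ cong ((+ length t - 1ℤ) *_) (ev₁-cong (trim-≈ f)) ⟩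
  (+ length t - 1ℤ) * ev₁ f              ∎
  where
  open ≡-Reasoning
  t = trim f

ev₁-reflect : ∀ n f → Deg≤ n f → ev₁ (reflect n f) ≡ ev₁ f
ev₁-reflect n       []          _       = ev₁-≈[] (reflect-[] n)
ev₁-reflect zero    (a ∷ [])    _       = refl
ev₁-reflect zero    (a ∷ _ ∷ _) (s≤s ())
ev₁-reflect (suc n) (a ∷ f)     (s≤s d) = begin
  ev₁ (reflect (suc n) (a ∷ f))  ≡⟨ cong ev₁ (reflect-suc-∷ n a f) ⟩
  ev₁ (reflect n f ++ a ∷ [])    ≡⟨ ev₁-++-[] (reflect n f) a ⟩
  ev₁ (reflect n f) + a          ≡⟨ cong (_+ a) (ev₁-reflect n f d) ⟩
  ev₁ f + a                      ≡⟨ ℤP.+-comm (ev₁ f) a ⟩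
  a + ev₁ f                      ∎
  where open ≡-Reasoning

ev₁-qint : ∀ c → ev₁ (qint c) ≡ + c
ev₁-qint zero    = refl
ev₁-qint (suc c) = trans (cong (λ z → 1ℤ + z) (ev₁-qint c)) (sym (ℤP.pos-+ 1 c))

ev₁-qpow : ∀ n → ev₁ (qpow n) ≡ 1ℤ
ev₁-qpow zero    = refl
ev₁-qpow (suc n) = trans (ℤP.+-identityˡ _) (ev₁-qpow n)

ev₁′-qpow : ∀ n → ev₁′ (qpow n) ≡ + n
ev₁′-qpow zero    = refl
ev₁′-qpow (suc n) = trans (cong₂ _+_ (ev₁′-qpow n) (ev₁-qpow n)) (trans (ℤP.+-comm (+ n) 1ℤ) (sym (ℤP.pos-+ 1 n)))

2ev₁′-qint : ∀ c → + 2 * ev₁′ (qint c) ≡ + c * (+ c - 1ℤ)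
2ev₁′-qint zero    = refl
2ev₁′-qint (suc c) = begin
  + 2 * (ev₁′ (qint c) + ev₁ (qint c))       ≡⟨ ℤP.*-distribˡ-+ (+ 2) (ev₁′ (qint c)) (ev₁ (qint c)) ⟩
  + 2 * ev₁′ (qint c) + + 2 * ev₁ (qint c)   ≡⟨ cong₂ (λ x y → x + + 2 * y) (2ev₁′-qint c) (ev₁-qint c) ⟩
  + c * (+ c - 1ℤ) + + 2 * + c               ≡⟨ step (+ c) ⟩
  (1ℤ + + c) * (1ℤ + + c - 1ℤ)               ≡⟨ cong (λ x → x * (x - 1ℤ)) (ℤP.pos-+ 1 c) ⟨
  + suc c * (+ suc c - 1ℤ)                   ∎
  where
  open ≡-Reasoning
  step : ∀ x → x * (x - 1ℤ) + + 2 * x ≡ (1ℤ + x) * (1ℤ + x - 1ℤ)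
  step = solve-∀

-- The integer matrix (a u ; b v), stored by columns.
record Mat₁ : Set where
  constructor mat₁
  field a b u v : ℤ

step₁ : ℕ → Mat₁ → Mat₁
step₁ c (mat₁ a b u v) = mat₁ (+ c * a - b) a (+ c * u - v) u

prod₁ : List ℕ → Mat₁
prod₁ []       = mat₁ 1ℤ 0ℤ 0ℤ 1ℤ
prod₁ (c ∷ cs) = step₁ c (prod₁ cs)

ev₁ₘ : Mat → Mat₁
ev₁ₘ (mat a b c d) = mat₁ (ev₁ a) (ev₁ c) (ev₁ b) (ev₁ d)

det-prod₁ : ∀ cs → let open Mat₁ (prod₁ cs) in a * v - u * b ≡ 1ℤ
det-prod₁ []       = refl
det-prod₁ (c ∷ cs) = trans (expand (+ c) a b u v) (det-prod₁ cs)
  where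
  open Mat₁ (prod₁ cs)
  expand : ∀ c a b u v → (c * a - b) * u - (c * u - v) * a ≡ a * v - u * b
  expand = solve-∀

ev₁-row₁ : ∀ c x y → ev₁ (qint (suc c) ⊗ x ⊕ neg (qpow c) ⊗ y) ≡ + suc c * ev₁ x - ev₁ y
ev₁-row₁ c x y = begin
  ev₁ (Q ⊗ x ⊕ P ⊗ y)                ≡⟨ ev₁-⊕ (Q ⊗ x) (P ⊗ y) ⟩
  ev₁ (Q ⊗ x) + ev₁ (P ⊗ y)          ≡⟨ cong₂ _+_ (ev₁-⊗ Q x) (ev₁-⊗ P y) ⟩
  ev₁ Q * ev₁ x + ev₁ P * ev₁ y      ≡⟨ cong₂ (λ p q → p * ev₁ x + q * ev₁ y) (ev₁-qint (suc c)) ev₁-P ⟩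
  + suc c * ev₁ x + - 1ℤ * ev₁ y     ≡⟨ cong (λ z → + suc c * ev₁ x + z) (ℤP.-1*i≡-i (ev₁ y)) ⟩
  + suc c * ev₁ x - ev₁ y            ∎
  where
  open ≡-Reasoning
  Q = qint (suc c)
  P = neg (qpow c)
  ev₁-P : ev₁ P ≡ - 1ℤ
  ev₁-P = trans (ev₁-scale (- 1ℤ) (qpow c)) (cong (- 1ℤ *_) (ev₁-qpow c))

ev₁-row₂ : ∀ x y → ev₁ (one ⊗ x ⊕ [] ⊗ y) ≡ ev₁ x
ev₁-row₂ x y = ev₁-cong (≈-trans (⊕-identityʳ (one ⊗ x)) (⊗-identityˡ x))

ev₁ₘ-M⁻· : ∀ c P → ev₁ₘ (M⁻ (suc c) · P) ≡ step₁ (suc c) (ev₁ₘ P)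
ev₁ₘ-M⁻· c (mat p q r s)
  rewrite ev₁-row₁ c p r | ev₁-row₁ c q s | ev₁-row₂ p r | ev₁-row₂ q s = refl

ev₁ₘ-prod : ∀ cs → All (1 ≤_) cs → ev₁ₘ (prod cs) ≡ prod₁ cs
ev₁ₘ-prod []            []          = refl
ev₁ₘ-prod (suc c ∷ cs) (s≤s _ ∷ 1≤cs) = trans (ev₁ₘ-M⁻· c (prod cs)) (cong (step₁ (suc c)) (ev₁ₘ-prod cs 1≤cs))

2ev₁′-row₁ : ∀ c x y → + 2 * ev₁′ (qint (suc c) ⊗ x ⊕ neg (qpow c) ⊗ y) ≡
             + suc c * (+ suc c - 1ℤ) * ev₁ x + + suc c * (+ 2 * ev₁′ x) - + 2 * + c * ev₁ y - + 2 * ev₁′ y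
2ev₁′-row₁ c x y = begin
  + 2 * ev₁′ (Q ⊗ x ⊕ P ⊗ y)
    ≡⟨ cong (+ 2 *_) (trans (ev₁′-⊕ (Q ⊗ x) (P ⊗ y)) (cong₂ _+_ (ev₁′-⊗ Q x) (ev₁′-⊗ P y))) ⟩
  + 2 * ((ev₁′ Q * ev₁ x + ev₁ Q * ev₁′ x) + (ev₁′ P * ev₁ y + ev₁ P * ev₁′ y))
    ≡⟨ regroup (ev₁′ Q) (ev₁ x) (ev₁ Q) (ev₁′ x) (ev₁′ P) (ev₁ y) (ev₁ P) (ev₁′ y) ⟩
  + 2 * ev₁′ Q * ev₁ x + ev₁ Q * (+ 2 * ev₁′ x) + + 2 * ev₁′ P * ev₁ y + ev₁ P * (+ 2 * ev₁′ y)
    ≡⟨ cong₂ _+_ (cong₂ _+_ (cong₂ _+_ (cong (_* ev₁ x) (2ev₁′-qint (suc c))) (cong (_* (+ 2 * ev₁′ x)) (ev₁-qint (suc c))))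
                            (cong (λ z → + 2 * z * ev₁ y) ev₁′-P))
                 (cong (_* (+ 2 * ev₁′ y)) ev₁-P) ⟩
  + suc c * (+ suc c - 1ℤ) * ev₁ x + + suc c * (+ 2 * ev₁′ x) + + 2 * - + c * ev₁ y + - 1ℤ * (+ 2 * ev₁′ y)
    ≡⟨ signs (+ suc c * (+ suc c - 1ℤ) * ev₁ x + + suc c * (+ 2 * ev₁′ x)) (+ c) (ev₁ y) (+ 2 * ev₁′ y) ⟩
  + suc c * (+ suc c - 1ℤ) * ev₁ x + + suc c * (+ 2 * ev₁′ x) - + 2 * + c * ev₁ y - + 2 * ev₁′ y
    ∎
  where
  open ≡-Reasoning
  Q = qint (suc c)
  P = neg (qpow c)
  ev₁-P : ev₁ P ≡ - 1ℤ
  ev₁-P = trans (ev₁-scale (- 1ℤ) (qpow c)) (cong (- 1ℤ *_) (ev₁-qpow c))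
  ev₁′-P : ev₁′ P ≡ - + c
  ev₁′-P = trans (ev₁′-scale (- 1ℤ) (qpow c)) (trans (cong (- 1ℤ *_) (ev₁′-qpow c)) (ℤP.-1*i≡-i (+ c)))
  regroup : ∀ q′ x q x′ p′ y p y′ → + 2 * ((q′ * x + q * x′) + (p′ * y + p * y′)) ≡
            + 2 * q′ * x + q * (+ 2 * x′) + + 2 * p′ * y + p * (+ 2 * y′)
  regroup = solve-∀
  signs : ∀ z c y w → z + + 2 * - c * y + - 1ℤ * w ≡ z - + 2 * c * y - w
  signs = solve-∀

2ev₁′-M⁻· : ∀ c n x y {a b u v} → ev₁ x ≡ a → ev₁ y ≡ b →
           + 2 * ev₁′ x ≡ + n * a + b + u → + 2 * ev₁′ y ≡ + n * b - a + b + v →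
           + 2 * ev₁′ (qint (suc c) ⊗ x ⊕ neg (qpow c) ⊗ y) ≡ + (c ℕ.+ n) * (+ suc c * a - b) + a + (+ suc c * u - v)
2ev₁′-M⁻· c n x y {u = u} {v} refl refl x′ y′ = begin
  + 2 * ev₁′ (qint (suc c) ⊗ x ⊕ neg (qpow c) ⊗ y)
    ≡⟨ 2ev₁′-row₁ c x y ⟩
  C * (C - 1ℤ) * a + C * (+ 2 * ev₁′ x) - + 2 * + c * b - + 2 * ev₁′ y
    ≡⟨ cong₂ (λ p q → C * (C - 1ℤ) * a + C * p - + 2 * + c * b - q) x′ y′ ⟩
  C * (C - 1ℤ) * a + C * (N * a + b + u) - + 2 * + c * b - (N * b - a + b + v)
    ≡⟨ subst₂ (λ C m → C * (C - 1ℤ) * a + C * (N * a + b + u) - + 2 * + c * b - (N * b - a + b + v)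
                       ≡ m * (C * a - b) + a + (C * u - v))
              (sym (ℤP.pos-+ 1 c)) (sym (ℤP.pos-+ c n)) (identity (+ c) N a b u v) ⟩
  + (c ℕ.+ n) * (C * a - b) + a + (C * u - v)
    ∎
  where
  open ≡-Reasoning
  C = + suc c
  N = + n
  a = ev₁ x
  b = ev₁ y
  identity : ∀ c N a b u v → (1ℤ + c) * (1ℤ + c - 1ℤ) * a + (1ℤ + c) * (N * a + b + u) - + 2 * c * b - (N * b - a + b + v)
                            ≡ (c + N) * ((1ℤ + c) * a - b) + a + ((1ℤ + c) * u - v)
  identity = solve-∀

-- The first column of 2P′(1) = N·P(1) + K·P(1) − P(1)·K for P = prod cs, where N = totalDegree cs and
-- K = (0 1 ; −1 1): the identity holds for each M⁻(c) and is preserved under products.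
2ev₁′-prod : ∀ cs → All (1 ≤_) cs → let open Mat₁ (prod₁ cs); N = + totalDegree cs in
             + 2 * ev₁′ (e₁₁ (prod cs)) ≡ N * a + b + u × + 2 * ev₁′ (e₂₁ (prod cs)) ≡ N * b - a + b + v
2ev₁′-prod []            []            = refl , refl
2ev₁′-prod (suc c ∷ cs) (s≤s _ ∷ 1≤cs) =
  2ev₁′-M⁻· c (totalDegree cs) x y ev₁x ev₁y (proj₁ IH) (proj₂ IH) , row₂
  where
  open Mat₁ (prod₁ cs)
  open ≡-Reasoning
  N = + totalDegree cs
  x = e₁₁ (prod cs)
  y = e₂₁ (prod cs)
  ev₁x : ev₁ x ≡ a
  ev₁x = cong Mat₁.a (ev₁ₘ-prod cs 1≤cs)
  ev₁y : ev₁ y ≡ b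
  ev₁y = cong Mat₁.b (ev₁ₘ-prod cs 1≤cs)
  IH = 2ev₁′-prod cs 1≤cs
  identity : ∀ c N a b u → N * a + b + u ≡ (c + N) * a - ((1ℤ + c) * a - b) + a + u
  identity = solve-∀
  row₂ : + 2 * ev₁′ (one ⊗ x ⊕ [] ⊗ y) ≡ + (c ℕ.+ totalDegree cs) * a - (+ suc c * a - b) + a + u
  row₂ = begin
    + 2 * ev₁′ (one ⊗ x ⊕ [] ⊗ y)  ≡⟨ cong (+ 2 *_) (ev₁′-cong (≈-trans (⊕-identityʳ (one ⊗ x)) (⊗-identityˡ x))) ⟩
    + 2 * ev₁′ x                   ≡⟨ proj₁ IH ⟩
    N * a + b + u                  ≡⟨ subst₂ (λ C m → N * a + b + u ≡ m * a - (C * a - b) + a + u)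
                                        (sym (ℤP.pos-+ 1 c)) (sym (ℤP.pos-+ c (totalDegree cs))) (identity (+ c) N a b u) ⟩
    + (c ℕ.+ totalDegree cs) * a - (+ suc c * a - b) + a + u ∎

-- Inequalities for cᵢ ≥ 2

-- A strict inequality x < y is written 0 ≤ y − x − 1.
0≤+ : ∀ n → 0ℤ ≤ℤ + n
0≤+ n = +≤+ z≤n

0≤-+ : ∀ {x y} → 0ℤ ≤ℤ x → 0ℤ ≤ℤ y → 0ℤ ≤ℤ x + y
0≤-+ = ℤP.+-mono-≤

0≤-* : ∀ {x y} → 0ℤ ≤ℤ x → 0ℤ ≤ℤ y → 0ℤ ≤ℤ x * y
0≤-* {+ m} {+ n} _ _ = subst (0ℤ ≤ℤ_) (ℤP.pos-* m n) (0≤+ (m ℕ.* n))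

0≤-by : ∀ {x y} → x ≡ y → 0ℤ ≤ℤ x → 0ℤ ≤ℤ y
0≤-by refl p = p

-- Satisfied by prod₁ cs when all cᵢ ≥ 2; the last two fields are there to make the family inductive.
record Bounds (A : Mat₁) : Set where
  open Mat₁ A
  field
    0≤b     : 0ℤ ≤ℤ b
    b<a     : 0ℤ ≤ℤ a - b - 1ℤ
    u≤0     : 0ℤ ≤ℤ - u
    u≤v     : 0ℤ ≤ℤ v - u
    1≤b+v   : 0ℤ ≤ℤ b + v - 1ℤ
    b+v≤a+u : 0ℤ ≤ℤ a + u - b - v

  0≤a : 0ℤ ≤ℤ a
  0≤a = 0≤-by (e a b) (0≤-+ (0≤-+ b<a 0≤b) (0≤+ 1))
    where
    e : ∀ a b → a - b - 1ℤ + b + + 1 ≡ a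
    e = solve-∀

bounds-step : ∀ k A → Bounds A → Bounds (step₁ (2 ℕ.+ k) A)
bounds-step k (mat₁ a b u v) B rewrite ℤP.pos-+ 2 k = record
  { 0≤b     = 0≤a
  ; b<a     = 0≤-by (e₂ a b K) (0≤-+ b<a (0≤-* (0≤+ k) 0≤a))
  ; u≤0     = 0≤-by (e₃ u v K) (0≤-+ (0≤-+ u≤v u≤0) (0≤-* (0≤+ k) u≤0))
  ; u≤v     = 0≤-by (e₄ u v K) (0≤-+ u≤v (0≤-* (0≤+ k) u≤0))
  ; 1≤b+v   = 0≤-by (e₅ a b u v) (0≤-+ b+v≤a+u 1≤b+v)
  ; b+v≤a+u = 0≤-by (e₆ a b u v K) (0≤-+ b+v≤a+u (0≤-* (0≤+ k) (0≤-+ (0≤-+ b+v≤a+u 1≤b+v) (0≤+ 1))))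
  }
  where
  open Bounds B
  K = + k
  e₂ : ∀ a b K → a - b - 1ℤ + K * a ≡ (+ 2 + K) * a - b - a - 1ℤ
  e₂ = solve-∀
  e₃ : ∀ u v K → v - u + - u + K * - u ≡ - ((+ 2 + K) * u - v)
  e₃ = solve-∀
  e₄ : ∀ u v K → v - u + K * - u ≡ u - ((+ 2 + K) * u - v)
  e₄ = solve-∀
  e₅ : ∀ a b u v → a + u - b - v + (b + v - 1ℤ) ≡ a + u - 1ℤ
  e₅ = solve-∀
  e₆ : ∀ a b u v K → a + u - b - v + K * (a + u - b - v + (b + v - 1ℤ) + + 1)
                     ≡ (+ 2 + K) * a - b + ((+ 2 + K) * u - v) - a - u
  e₆ = solve-∀

bounds-prod₁ : ∀ cs → All (2 ≤_) cs → Bounds (prod₁ cs)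
bounds-prod₁ []                []                    = record
  { 0≤b = 0≤+ 0 ; b<a = 0≤+ 0 ; u≤0 = 0≤+ 0 ; u≤v = 0≤+ 1 ; 1≤b+v = 0≤+ 0 ; b+v≤a+u = 0≤+ 0 }
bounds-prod₁ (suc (suc k) ∷ cs) (s≤s (s≤s _) ∷ 2≤cs) = bounds-step k (prod₁ cs) (bounds-prod₁ cs 2≤cs)

b+u-window : ∀ {A} → Bounds A → let open Mat₁ A in 0ℤ ≤ℤ b + u + a - 1ℤ × 0ℤ ≤ℤ a - (b + u) - 1ℤ
b+u-window {mat₁ a b u v} B = 0≤-by (e₁ a b u v) (0≤-+ 0≤b (0≤-+ b+v≤a+u 1≤b+v)) , 0≤-by (e₂ a b u) (0≤-+ b<a u≤0)
  where
  open Bounds B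
  e₁ : ∀ a b u v → b + (a + u - b - v + (b + v - 1ℤ)) ≡ b + u + a - 1ℤ
  e₁ = solve-∀
  e₂ : ∀ a b u → a - b - 1ℤ + - u ≡ a - (b + u) - 1ℤ
  e₂ = solve-∀

≥1⇒+suc : ∀ {x} → 0ℤ ≤ℤ x - 1ℤ → Σ ℕ λ α → x ≡ + suc α
≥1⇒+suc {x} 0≤x-1 = ℤ.∣ x - 1ℤ ∣ , (begin
  x                       ≡⟨ e x ⟩
  1ℤ + (x - 1ℤ)           ≡⟨ cong (λ z → 1ℤ + z) (ℤP.0≤i⇒+∣i∣≡i 0≤x-1) ⟨
  1ℤ + + ℤ.∣ x - 1ℤ ∣     ≡⟨ ℤP.pos-+ 1 ℤ.∣ x - 1ℤ ∣ ⟨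
  + suc ℤ.∣ x - 1ℤ ∣      ∎)
  where
  open ≡-Reasoning
  e : ∀ x → x ≡ 1ℤ + (x - 1ℤ)
  e = solve-∀

0≤b<a⇒a≡+suc : ∀ {A B} → 0ℤ ≤ℤ B → 0ℤ ≤ℤ A - B - 1ℤ → Σ ℕ λ α → A ≡ + suc α
0≤b<a⇒a≡+suc {A} {B} 0≤B B<A = ≥1⇒+suc (0≤-by (e A B) (0≤-+ B<A 0≤B))
  where
  e : ∀ a b → a - b - 1ℤ + b ≡ a - 1ℤ
  e = solve-∀

bounds⇒a≡+suc : ∀ {A} → Bounds A → Σ ℕ λ α → Mat₁.a A ≡ + suc α
bounds⇒a≡+suc B = 0≤b<a⇒a≡+suc 0≤b b<a
  where open Bounds B

nonNeg+1≢0 : ∀ {x} → 0ℤ ≤ℤ x → x + 1ℤ ≢ 0ℤ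
nonNeg+1≢0 {+ n} _ e = ℕP.m+1+n≢0 n (ℤP.+-injective e)

multiple-in-window : ∀ k {n d} → 0ℤ ≤ℤ n → d ≡ k * n → 0ℤ ≤ℤ d + n - 1ℤ → 0ℤ ≤ℤ n - d - 1ℤ → d ≡ 0ℤ
multiple-in-window (+ zero) _ d≡ _ _ = d≡
multiple-in-window (+ suc m) {n} 0≤n refl _ hi =
  ⊥-elim (nonNeg+1≢0 (0≤-+ hi (0≤-* (0≤+ m) 0≤n))
    (subst (λ C → n - C * n - 1ℤ + + m * n + 1ℤ ≡ 0ℤ) (sym (ℤP.pos-+ 1 m)) (e (+ m) n)))
  where
  e : ∀ m n → n - (1ℤ + m) * n - 1ℤ + m * n + 1ℤ ≡ 0ℤ
  e = solve-∀
multiple-in-window -[1+ m ] {n} 0≤n refl lo _ =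
  ⊥-elim (nonNeg+1≢0 (0≤-+ lo (0≤-* (0≤+ m) 0≤n))
    (subst (λ C → - C * n + n - 1ℤ + + m * n + 1ℤ ≡ 0ℤ) (sym (ℤP.pos-+ 1 m)) (e (+ m) n)))
  where
  e : ∀ m n → - (1ℤ + m) * n + n - 1ℤ + m * n + 1ℤ ≡ 0ℤ
  e = solve-∀

quotient-unique : ∀ c d {A B B′} → 0ℤ ≤ℤ B → 0ℤ ≤ℤ A - B - 1ℤ → 0ℤ ≤ℤ B′ → 0ℤ ≤ℤ A - B′ - 1ℤ →
                  + c * A - B ≡ + d * A - B′ → c ≡ d × B ≡ B′
quotient-unique c d {A} {B} {B′} 0≤B B<A 0≤B′ B′<A eq = c≡d , B≡B′
  where
  α = proj₁ (0≤b<a⇒a≡+suc {A} 0≤B B<A)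
  A≡ : A ≡ + suc α
  A≡ = proj₂ (0≤b<a⇒a≡+suc {A} 0≤B B<A)
  move : ∀ c d a b b′ → c * a - b ≡ d * a - b′ → b - b′ ≡ (c - d) * a
  move c d a b b′ eq = trans (e₁ c a b b′) (trans (cong (λ z → c * a - b′ - z) eq) (e₂ c d a b′))
    where
    e₁ : ∀ c a b b′ → b - b′ ≡ c * a - b′ - (c * a - b)
    e₁ = solve-∀
    e₂ : ∀ c d a b′ → c * a - b′ - (d * a - b′) ≡ (c - d) * a
    e₂ = solve-∀
  lo : ∀ a b b′ → a - b′ - 1ℤ + b ≡ b - b′ + a - 1ℤ
  lo = solve-∀
  hi : ∀ a b b′ → a - b - 1ℤ + b′ ≡ a - (b - b′) - 1ℤ
  hi = solve-∀
  B-B′≡[c-d]A : B - B′ ≡ (+ c - + d) * A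
  B-B′≡[c-d]A = move (+ c) (+ d) A B B′ eq
  B-B′≡0 : B - B′ ≡ 0ℤ
  B-B′≡0 = multiple-in-window (+ c - + d) (subst (0ℤ ≤ℤ_) (sym A≡) (0≤+ (suc α))) B-B′≡[c-d]A
             (0≤-by (lo A B B′) (0≤-+ B′<A 0≤B)) (0≤-by (hi A B B′) (0≤-+ B<A 0≤B′))
  B≡B′ : B ≡ B′
  B≡B′ = ℤP.i-j≡0⇒i≡j B B′ B-B′≡0
  c≡d : c ≡ d
  c≡d = ℤP.+-injective (ℤP.i-j≡0⇒i≡j (+ c) (+ d) (ℤP.*-cancelʳ-≡ (+ c - + d) 0ℤ (+ suc α)
          (subst (λ a → (+ c - + d) * a ≡ 0ℤ) A≡ (trans (sym B-B′≡[c-d]A) B-B′≡0))))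

prod₁-injective : ∀ cs ds → All (2 ≤_) cs → All (2 ≤_) ds →
                  Mat₁.a (prod₁ cs) ≡ Mat₁.a (prod₁ ds) → Mat₁.b (prod₁ cs) ≡ Mat₁.b (prod₁ ds) → cs ≡ ds
prod₁-injective []       []       _            _            _   _   = refl
prod₁-injective []       (d ∷ ds) _            (_ ∷ 2≤ds)   _   b≡
  with () ← trans b≡ (proj₂ (bounds⇒a≡+suc (bounds-prod₁ ds 2≤ds)))
prod₁-injective (c ∷ cs) []       (_ ∷ 2≤cs)   _            _   b≡
  with () ← trans (sym b≡) (proj₂ (bounds⇒a≡+suc (bounds-prod₁ cs 2≤cs)))
prod₁-injective (c ∷ cs) (d ∷ ds) (_ ∷ 2≤cs)   (_ ∷ 2≤ds)   a≡  b≡ =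
  cong₂ _∷_ c≡d (prod₁-injective cs ds 2≤cs 2≤ds b≡ B≡B′)
  where
  open Bounds (bounds-prod₁ cs 2≤cs)
  Bds = bounds-prod₁ ds 2≤ds
  A = Mat₁.a (prod₁ cs)
  B′<A : 0ℤ ≤ℤ A - Mat₁.b (prod₁ ds) - 1ℤ
  B′<A = subst (λ x → 0ℤ ≤ℤ x - Mat₁.b (prod₁ ds) - 1ℤ) (sym b≡) (Bounds.b<a Bds)
  quotients = quotient-unique c d 0≤b b<a (Bounds.0≤b Bds) B′<A (trans a≡ (cong (λ x → + d * x - Mat₁.b (prod₁ ds)) (sym b≡)))
  c≡d = proj₁ quotients
  B≡B′ = proj₂ quotients

-- The value of the continued fraction

record Represents (x : ℚᵘ) (A B : ℤ) : Set where
  constructor represents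
  field cross : ↥ x * B ≡ A * ↧ x
open Represents public

represents-≃ : ∀ x y {A B} → x ≃ y → Represents y A B → Represents x A B
represents-≃ (mkℚᵘ n dx) (mkℚᵘ m dy) {A} {B} (*≡* e) (represents r) = represents $
  ℤP.*-cancelʳ-≡ (n * B) (A * + suc dx) (+ suc dy) (begin
    n * B * + suc dy      ≡⟨ swap n B (+ suc dy) ⟩
    n * + suc dy * B      ≡⟨ cong (_* B) e ⟩
    m * + suc dx * B      ≡⟨ swap m (+ suc dx) B ⟩
    m * B * + suc dx      ≡⟨ cong (_* + suc dx) r ⟩
    A * + suc dy * + suc dx ≡⟨ swap A (+ suc dy) (+ suc dx) ⟩
    A * + suc dx * + suc dy ∎)
  where
  open ≡-Reasoning
  swap : ∀ x y z → x * y * z ≡ x * z * y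
  swap = solve-∀

represents-+ : ∀ x y {A B C D} → Represents x A B → Represents y C D → Represents (x ℚᵘ.+ y) (A * D + C * B) (B * D)
represents-+ (mkℚᵘ n dx) (mkℚᵘ m dy) {A} {B} {C} {D} (represents r₁) (represents r₂) = represents $ begin
  (n * + suc dy + m * + suc dx) * (B * D)             ≡⟨ e₁ n (+ suc dy) m (+ suc dx) B D ⟩
  n * B * (+ suc dy * D) + m * D * (+ suc dx * B)     ≡⟨ cong₂ (λ p q → p * (+ suc dy * D) + q * (+ suc dx * B)) r₁ r₂ ⟩
  A * + suc dx * (+ suc dy * D) + C * + suc dy * (+ suc dx * B) ≡⟨ e₂ A (+ suc dx) (+ suc dy) D C B ⟩
  (A * D + C * B) * (+ suc dx * + suc dy)             ≡⟨ cong ((A * D + C * B) *_) (ℤP.pos-* (suc dx) (suc dy)) ⟨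
  (A * D + C * B) * + (suc dx ℕ.* suc dy)             ∎
  where
  open ≡-Reasoning
  e₁ : ∀ n y m x B D → (n * y + m * x) * (B * D) ≡ n * B * (y * D) + m * D * (x * B)
  e₁ = solve-∀
  e₂ : ∀ A x y D C B → A * x * (y * D) + C * y * (x * B) ≡ (A * D + C * B) * (x * y)
  e₂ = solve-∀

represents-neg : ∀ x {A B} → Represents x A B → Represents (ℚᵘ.- x) (- A) B
represents-neg (mkℚᵘ n d) {A} {B} (represents r) = represents $
  trans (sym (ℤP.neg-distribˡ-* n B)) (trans (cong -_ r) (ℤP.neg-distribˡ-* A (+ suc d)))

represents-ℕ : ∀ c → Represents (toℚᵘ ((+ c) ℚ./ 1)) (+ c) 1ℤ
represents-ℕ c rewrite ℚP.normalize-coprime {c} {0} (Coprimality.sym (1-coprimeTo c)) = represents refl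

represents-inv : ∀ p {α β} → Represents (toℚᵘ p) (+ suc α) (+ suc β) → Represents (toℚᵘ (inv p)) (+ suc β) (+ suc α)
represents-inv (mkℚ (+ zero)  d _) (represents ())
represents-inv (mkℚ -[1+ n ]  d _) (represents ())
represents-inv (mkℚ (+ suc n) d _) {α} {β} (represents r) = represents $
  trans (ℤP.*-comm (+ suc d) (+ suc α)) (trans (sym r) (ℤP.*-comm (+ suc n) (+ suc β)))

represents-step : ∀ p c {A B α β} → A ≡ + suc α → B ≡ + suc β → Represents (toℚᵘ p) A B →
                  Represents (toℚᵘ ((+ c) ℚ./ 1 ℚ.- inv p)) (+ c * A - B) A
represents-step p c {A} {B} refl refl r =
  represents-≃ (toℚᵘ (c/1 ℚ.- inv p)) sum-value homo (subst₂ (Represents sum-value) (e (+ c) A B) (ℤP.*-identityˡ A) sum)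
  where
  c/1 = (+ c) ℚ./ 1
  sum-value = toℚᵘ c/1 ℚᵘ.+ ℚᵘ.- toℚᵘ (inv p)
  homo : toℚᵘ (c/1 ℚ.- inv p) ≃ sum-value
  homo = ℚᵘP.≃-trans (ℚP.toℚᵘ-homo-+ c/1 (ℚ.- inv p)) (ℚᵘP.+-congʳ (toℚᵘ c/1) (ℚP.toℚᵘ-homo‿- (inv p)))
  sum : Represents sum-value (+ c * A + - B * 1ℤ) (1ℤ * A)
  sum = represents-+ (toℚᵘ c/1) (ℚᵘ.- toℚᵘ (inv p)) (represents-ℕ c) (represents-neg (toℚᵘ (inv p)) (represents-inv p r))
  e : ∀ c A B → c * A + - B * 1ℤ ≡ c * A - B
  e = solve-∀

ncf-represents : ∀ c cs → All (2 ≤_) (c ∷ cs) →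
                 Represents (toℚᵘ (ncfList c cs)) (Mat₁.a (prod₁ (c ∷ cs))) (Mat₁.b (prod₁ (c ∷ cs)))
ncf-represents c []       _ = subst (λ A → Represents (toℚᵘ ((+ c) ℚ./ 1)) A 1ℤ) (e (+ c)) (represents-ℕ c)
  where
  e : ∀ c → c ≡ c * 1ℤ - 0ℤ
  e = solve-∀
ncf-represents c (d ∷ ds) (_ ∷ 2≤dds@(_ ∷ 2≤ds)) =
  represents-step (ncfList d ds) c (proj₂ (bounds⇒a≡+suc (bounds-prod₁ (d ∷ ds) 2≤dds)))
    (proj₂ (bounds⇒a≡+suc (bounds-prod₁ ds 2≤ds))) (ncf-represents d ds 2≤dds)

ncf-cross : ∀ r s c cs → All (2 ≤_) (c ∷ cs) → Coprime r (suc s) → ncfList c cs ≡ (+ r) ℚ./ suc s →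
            + r * Mat₁.b (prod₁ (c ∷ cs)) ≡ Mat₁.a (prod₁ (c ∷ cs)) * + suc s
ncf-cross r s c cs 2≤ccs r⊥s ncf≡ =
  subst (λ p → Represents (toℚᵘ p) (Mat₁.a (prod₁ (c ∷ cs))) (Mat₁.b (prod₁ (c ∷ cs))))
        (trans ncf≡ (ℚP.normalize-coprime r⊥s)) (ncf-represents c cs 2≤ccs) .cross

det≡1⇒coprime : ∀ {α β u v} → + α * v - u * + β ≡ 1ℤ → Coprime α β
det≡1⇒coprime {α} {β} {u} {v} det {d} (d∣α , d∣β) = ℕD.∣1⇒≡1 (ℤD.∣⇒∣ᵤ {+ d} {1ℤ} (subst (ℤD._∣_ (+ d)) det
  (ℤD.∣m∣n⇒∣m-n (ℤD.∣m⇒∣m*n v (ℤD.∣ᵤ⇒∣ {+ d} {+ α} d∣α)) (ℤD.∣n⇒∣m*n u (ℤD.∣ᵤ⇒∣ {+ d} {+ β} d∣β)))))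

-- r/s and a/b are both in lowest terms, the latter as av − ub = 1.
lowest-terms-unique : ∀ {r s a b u v} → Coprime r s → s < r → a * v - u * b ≡ 1ℤ → 0ℤ ≤ℤ a → 0ℤ ≤ℤ b →
                      + r * b ≡ a * + s → a ≡ + r × b ≡ + s
lowest-terms-unique {r} {s} {+ α} {+ β} {u} {v} r⊥s s<r det _ _ cross = cong +_ α≡r , cong +_ β≡s
  where
  rβ≡αs : r ℕ.* β ≡ α ℕ.* s
  rβ≡αs = ℤP.+-injective (trans (ℤP.pos-* r β) (trans cross (sym (ℤP.pos-* α s))))
  r∣α : r ℕD.∣ α
  r∣α = coprime-divisor r⊥s (ℕD.divides β (trans (ℕP.*-comm s α) (trans (sym rβ≡αs) (ℕP.*-comm r β))))
  α∣r : α ℕD.∣ r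
  α∣r = coprime-divisor (det≡1⇒coprime {u = u} {v = v} det) (ℕD.divides s (trans (ℕP.*-comm β r) (trans rβ≡αs (ℕP.*-comm α s))))
  α≡r : α ≡ r
  α≡r = ℕD.∣-antisym α∣r r∣α
  β≡s : β ≡ s
  β≡s = ℕP.*-cancelˡ-≡ β s r {{ℕ.>-nonZero (ℕP.<-≤-trans (s≤s z≤n) s<r)}}
          (trans rβ≡αs (cong (ℕ._* s) α≡r))

-- Palindromicity of R

All-reverse : ∀ {P : ℕ → Set} cs → All P cs → All P (reverse cs)
All-reverse []       []         = []
All-reverse (c ∷ cs) (pc ∷ pcs) = subst (All _) (sym (LP.unfold-reverse c cs)) (AllP.∷ʳ⁺ (All-reverse cs pcs) pc)

2≤⇒1≤ : ∀ {cs} → All (2 ≤_) cs → All (1 ≤_) cs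
2≤⇒1≤ = All.map (ℕP.≤-trans (s≤s z≤n))

R≈e₁₁ : ∀ cs → PolyPair.fst (MprodList cs) ≈ e₁₁ (prod cs)
R≈e₁₁ cs = proj₁ (MprodList≈prod cs)

e₁₁-prod-constant≡1 : ∀ cs → All (2 ≤_) cs → coeff (e₁₁ (prod cs)) 0 ≡ 1ℤ
e₁₁-prod-constant≡1 []                 []                    = refl
e₁₁-prod-constant≡1 (suc (suc k) ∷ cs) (s≤s (s≤s _) ∷ 2≤cs) = begin
  coeff (Q ⊗ x ⊕ P ⊗ y) 0             ≡⟨ coeff-⊕ (Q ⊗ x) (P ⊗ y) 0 ⟩
  coeff (Q ⊗ x) 0 + coeff (P ⊗ y) 0     ≡⟨ cong₂ _+_ (coeff-⊗-0 Q x) (coeff-⊗-0 P y) ⟩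
  1ℤ * coeff x 0 + 0ℤ * coeff y 0       ≡⟨ cong (λ z → 1ℤ * z + 0ℤ * coeff y 0) (e₁₁-prod-constant≡1 cs 2≤cs) ⟩
  1ℤ                                    ∎
  where
  open ≡-Reasoning
  Q = qint (2 ℕ.+ k)
  P = neg (qpow (suc k))
  x = e₁₁ (prod cs)
  y = e₂₁ (prod cs)

prod₁-reverse : ∀ cs → All (1 ≤_) cs →
                Mat₁.a (prod₁ (reverse cs)) ≡ Mat₁.a (prod₁ cs) × Mat₁.b (prod₁ (reverse cs)) ≡ - Mat₁.u (prod₁ cs)
prod₁-reverse cs 1≤cs = a≡ , b≡
  where
  open ≡-Reasoning
  rs = reverse cs
  1≤rs = All-reverse cs 1≤cs
  ev₁ₘ-rs = ev₁ₘ-prod rs 1≤rs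
  ev₁ₘ-cs = ev₁ₘ-prod cs 1≤cs
  a≡ = begin
    Mat₁.a (prod₁ rs)                                 ≡⟨ cong Mat₁.a ev₁ₘ-rs ⟨
    ev₁ (e₁₁ (prod rs))                               ≡⟨ ev₁-cong (≈₁₁ (reflectₘ-prod cs 1≤cs)) ⟨
    ev₁ (reflect (totalDegree cs) (e₁₁ (prod cs)))    ≡⟨ ev₁-reflect (totalDegree cs) (e₁₁ (prod cs)) (deg₁₁ (Deg≤ₘ-prod cs)) ⟩
    ev₁ (e₁₁ (prod cs))                               ≡⟨ cong Mat₁.a ev₁ₘ-cs ⟩
    Mat₁.a (prod₁ cs)                                 ∎
  b≡ = begin
    Mat₁.b (prod₁ rs)                                 ≡⟨ cong Mat₁.b ev₁ₘ-rs ⟨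
    ev₁ (e₂₁ (prod rs))                               ≡⟨ ev₁-reflect (totalDegree rs) (e₂₁ (prod rs)) (deg₂₁ (Deg≤ₘ-prod rs)) ⟨
    ev₁ (reflect (totalDegree rs) (e₂₁ (prod rs)))    ≡⟨ ev₁-cong (≈₂₁ (reflectₘ-prod rs 1≤rs)) ⟩
    ev₁ (neg (e₁₂ (prod (reverse rs))))               ≡⟨ cong (λ l → ev₁ (neg (e₁₂ (prod l)))) (LP.reverse-involutive cs) ⟩
    ev₁ (neg (e₁₂ (prod cs)))                         ≡⟨ ev₁-scale (- 1ℤ) (e₁₂ (prod cs)) ⟩
    - 1ℤ * ev₁ (e₁₂ (prod cs))                        ≡⟨ ℤP.-1*i≡-i _ ⟩
    - ev₁ (e₁₂ (prod cs))                             ≡⟨ cong (λ A → - Mat₁.u A) ev₁ₘ-cs ⟩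
    - Mat₁.u (prod₁ cs)                               ∎

palindromic⇒b+u≡0 : ∀ cs → All (2 ≤_) cs → Palindromic (PolyPair.fst (MprodList cs)) →
                    let open Mat₁ (prod₁ cs) in b + u ≡ 0ℤ
palindromic⇒b+u≡0 cs 2≤cs pal =
  multiple-in-window (K - N) (Bounds.0≤a B) b+u≡[K-N]a (proj₁ (b+u-window B)) (proj₂ (b+u-window B))
  where
  open Mat₁ (prod₁ cs)
  open ≡-Reasoning
  R = PolyPair.fst (MprodList cs)
  x = e₁₁ (prod cs)
  B = bounds-prod₁ cs 2≤cs
  K = + length (trim R) - 1ℤ
  N = + totalDegree cs
  ev₁R≡a : ev₁ R ≡ a
  ev₁R≡a = trans (ev₁-cong (R≈e₁₁ cs)) (cong Mat₁.a (ev₁ₘ-prod cs (2≤⇒1≤ 2≤cs)))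
  e₁ : ∀ N a b u → b + u ≡ N * a + b + u - N * a
  e₁ = solve-∀
  e₂ : ∀ w → + 2 * w ≡ w + w
  e₂ = solve-∀
  e₃ : ∀ K N a → K * a - N * a ≡ (K - N) * a
  e₃ = solve-∀
  b+u≡[K-N]a : b + u ≡ (K - N) * a
  b+u≡[K-N]a = begin
    b + u                   ≡⟨ e₁ N a b u ⟩
    N * a + b + u - N * a   ≡⟨ cong (_- N * a) (proj₁ (2ev₁′-prod cs (2≤⇒1≤ 2≤cs))) ⟨
    + 2 * ev₁′ x - N * a    ≡⟨ cong (λ z → + 2 * z - N * a) (ev₁′-cong (R≈e₁₁ cs)) ⟨
    + 2 * ev₁′ R - N * a    ≡⟨ cong (_- N * a) (e₂ (ev₁′ R)) ⟩
    ev₁′ R + ev₁′ R - N * a ≡⟨ cong (_- N * a) (palindromic⇒2ev₁′ R pal) ⟩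
    K * ev₁ R - N * a       ≡⟨ cong (λ z → K * z - N * a) ev₁R≡a ⟩
    K * a - N * a           ≡⟨ e₃ K N a ⟩
    (K - N) * a             ∎

b+u≡0⇒palindromic : ∀ cs → All (2 ≤_) cs → (let open Mat₁ (prod₁ cs) in b + u ≡ 0ℤ) →
                    Palindromic (PolyPair.fst (MprodList cs))
b+u≡0⇒palindromic cs 2≤cs b+u≡0 =
  subst (λ t → reverse t ≡ t) (sym (trim-cong (R≈e₁₁ cs)))
    (reflection-fixed⇒palindrome N (trim-trimmed x) (trim-≈ x) (deg₁₁ (Deg≤ₘ-prod cs)) (e₁₁-prod-constant≡1 cs 2≤cs) fixed)
  where
  open Mat₁ (prod₁ cs)
  x = e₁₁ (prod cs)
  N = totalDegree cs
  1≤cs = 2≤⇒1≤ 2≤cs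
  -u≡b : - u ≡ b
  -u≡b = trans (e b u) (trans (cong (λ z → b - z) b+u≡0) (ℤP.+-identityʳ b))
    where
    e : ∀ b u → - u ≡ b - (b + u)
    e = solve-∀
  reverse≡ : reverse cs ≡ cs
  reverse≡ = prod₁-injective (reverse cs) cs (All-reverse cs 2≤cs) 2≤cs
    (proj₁ (prod₁-reverse cs 1≤cs)) (trans (proj₂ (prod₁-reverse cs 1≤cs)) -u≡b)
  fixed : reflect N x ≈ x
  fixed = ≈-trans (≈₁₁ (reflectₘ-prod cs 1≤cs)) (≈-reflexive (cong (λ l → e₁₁ (prod l)) reverse≡))

palindromic⇔b+u≡0 : ∀ cs → All (2 ≤_) cs →
                    Palindromic (PolyPair.fst (MprodList cs)) ⇔ (let open Mat₁ (prod₁ cs) in b + u ≡ 0ℤ)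
palindromic⇔b+u≡0 cs 2≤cs = mk⇔ (palindromic⇒b+u≡0 cs 2≤cs) (b+u≡0⇒palindromic cs 2≤cs)

det⇒s²-1≡s[s+u]-vr : ∀ {r s u v} → + r * v - u * + s ≡ 1ℤ → + (s ℕ.* s) - 1ℤ ≡ + s * (+ s + u) + - v * + r
det⇒s²-1≡s[s+u]-vr {r} {s} {u} {v} det = begin
  + (s ℕ.* s) - 1ℤ                  ≡⟨ cong (_- 1ℤ) (ℤP.pos-* s s) ⟩
  + s * + s - 1ℤ                    ≡⟨ cong (λ z → + s * + s - z) det ⟨
  + s * + s - (+ r * v - u * + s)   ≡⟨ e (+ s) u (+ r) v ⟩
  + s * (+ s + u) + - v * + r       ∎
  where
  open ≡-Reasoning
  e : ∀ s u r v → s * s - (r * v - u * s) ≡ s * (s + u) + - v * r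
  e = solve-∀

s+u≡0⇒r∣s²-1 : ∀ {r s u v} → + r * v - u * + s ≡ 1ℤ → + s + u ≡ 0ℤ → + r ∣ + (s ℕ.* s) - 1ℤ
s+u≡0⇒r∣s²-1 {r} {s} {u} {v} det s+u≡0 = ℤD.∣⇒∣ᵤ (ℤD.divides (- v) (begin
  + (s ℕ.* s) - 1ℤ                  ≡⟨ det⇒s²-1≡s[s+u]-vr {r} {s} {u} {v} det ⟩
  + s * (+ s + u) + - v * + r       ≡⟨ cong (λ z → + s * z + - v * + r) s+u≡0 ⟩
  + s * 0ℤ + - v * + r              ≡⟨ e (+ s) (- v * + r) ⟩
  - v * + r                         ∎))
  where
  open ≡-Reasoning
  e : ∀ s x → s * 0ℤ + x ≡ x
  e = solve-∀

r∣s²-1⇒r∣s+u : ∀ {r s u v} → Coprime r s → + r * v - u * + s ≡ 1ℤ → + r ∣ + (s ℕ.* s) - 1ℤ → + r ℤD.∣ + s + u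
r∣s²-1⇒r∣s+u {r} {s} {u} {v} r⊥s det r∣s²-1 =
  ℤD.∣ᵤ⇒∣ {+ r} {+ s + u} $ coprime-divisor r⊥s $ ℕD.divides ℤ.∣ k + v ∣ $ begin
    s ℕ.* ℤ.∣ + s + u ∣       ≡⟨ ℤP.abs-* (+ s) (+ s + u) ⟨
    ℤ.∣ + s * (+ s + u) ∣     ≡⟨ cong ℤ.∣_∣ s[s+u]≡[k+v]r ⟩
    ℤ.∣ (k + v) * + r ∣       ≡⟨ ℤP.abs-* (k + v) (+ r) ⟩
    ℤ.∣ k + v ∣ ℕ.* r         ∎
  where
  open ≡-Reasoning
  r∣s²-1ˢ : + r ℤD.∣ + (s ℕ.* s) - 1ℤ
  r∣s²-1ˢ = ℤD.∣ᵤ⇒∣ {+ r} {+ (s ℕ.* s) - 1ℤ} r∣s²-1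
  k = ℤD._∣_.quotient r∣s²-1ˢ
  e : ∀ x v r → x ≡ x + - v * r + v * r
  e = solve-∀
  s[s+u]≡[k+v]r : + s * (+ s + u) ≡ (k + v) * + r
  s[s+u]≡[k+v]r = begin
    + s * (+ s + u)                       ≡⟨ e (+ s * (+ s + u)) v (+ r) ⟩
    + s * (+ s + u) + - v * + r + v * + r ≡⟨ cong (_+ v * + r) (det⇒s²-1≡s[s+u]-vr {r} {s} {u} {v} det) ⟨
    + (s ℕ.* s) - 1ℤ + v * + r            ≡⟨ cong (_+ v * + r) (ℤD._∣_.equality r∣s²-1ˢ) ⟩
    k * + r + v * + r                     ≡⟨ ℤP.*-distribʳ-+ (+ r) k v ⟨
    (k + v) * + r                         ∎

b+u≡0⇔r∣s²-1 : ∀ {r s} A → Bounds A → (let open Mat₁ A in a * v - u * b ≡ 1ℤ) → Coprime r s →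
               Mat₁.a A ≡ + r → Mat₁.b A ≡ + s → (let open Mat₁ A in b + u ≡ 0ℤ ⇔ + r ∣ + (s ℕ.* s) - 1ℤ)
b+u≡0⇔r∣s²-1 {r} {s} (mat₁ _ _ u v) B det r⊥s refl refl = mk⇔ (s+u≡0⇒r∣s²-1 {r} {s} {u} {v} det) λ r∣s²-1 →
  let r∣s+u = r∣s²-1⇒r∣s+u {r} {s} {u} {v} r⊥s det r∣s²-1
  in multiple-in-window (ℤD._∣_.quotient r∣s+u) (0≤+ r) (ℤD._∣_.equality r∣s+u) (proj₁ (b+u-window B)) (proj₂ (b+u-window B))

corollary3p8 : (r s : ℕ) .{{_ : NonZero s}} → Coprime r s → s < r →
    (cs : List⁺ ℕ) → All (2 ≤_) (toList cs) → ncf cs ≡ (+ r) ℚ./ s →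
    (Palindromic (Rpoly cs) ⇔ ((+ r) ∣ ((+ (s ℕ.* s)) ℤ.- 1ℤ)))
corollary3p8 r (suc s) r⊥s s<r (c ∷ cs) 2≤ ncf≡ =
  ⇔.trans (palindromic⇔b+u≡0 L 2≤) (b+u≡0⇔r∣s²-1 (prod₁ L) B (det-prod₁ L) r⊥s (proj₁ a,b≡r,s) (proj₂ a,b≡r,s))
  where
  L = c ∷ cs
  B = bounds-prod₁ L 2≤
  a,b≡r,s = lowest-terms-unique {u = Mat₁.u (prod₁ L)} {v = Mat₁.v (prod₁ L)} r⊥s s<r (det-prod₁ L)
              (Bounds.0≤a B) (Bounds.0≤b B) (ncf-cross r s c cs 2≤ r⊥s ncf≡)
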